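{- Let $F=\mathbb{Q}(\sqrt{ -1})$ or $F=\mathbb{Q}(\sqrt{ -3})$, $R=\mathcal{O}_F$, $I$ a fractional ideal of $F$ and $\rho\in O^+(F)$ of finite order. Then $Z_{I,\rho}(s)=\frac12 Z^+_{R,\rho}(s)$.
   Context: $F$ is regarded as a quadratic space over $\mathbb{Q}$ with quadratic form $N_{F/\mathbb{Q}}$; $O(F)$ is its orthogonal group and $O^+(F)=O(F)\cap\mathrm{SL}(F)$. For a $\mathbb{Z}$-lattice $L$ on $F$ and $\rho$ of finite order, \[Z_{L,\rho}(s)=\sum_{K\subseteq L,\ |L:K|<\infty,\ \rho(K)=K}\frac{|L:K|^{ -s}}{\#\{\sigma\in O(F):\sigma(K)\subseteq L\}},\] and $Z^+_{L,\rho}$ is defined the same way with $O(F)$ replaced by $O^+(F)$. -}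

module Defs where

open import Data.Nat using (ℕ; suc)
open import Data.Integer using (ℤ; +_)
open import Data.Rational using (ℚ; _+_; _*_; _-_; -_; 0ℚ; 1ℚ; ½; _/_)
open import Data.Product using (Σ; _×_; _,_; ∃)
open import Data.List using (List; length; foldr)
open import Data.List.Relation.Unary.All using (All)
open import Data.List.Relation.Unary.Any using (Any)
open import Data.List.Relation.Unary.AllPairs using (AllPairs)
open import Data.List.Relation.Binary.Pointwise using (Pointwise)
open import Relation.Binary.PropositionalEquality using (_≡_)
open import Relation.Nullary using (¬_)

-- The field F = ℚ(√-d), d ∈ {1,3}; an element (a , b) stands for a + b√-d.
-- As a ℚ-vector space F = ℚ², with basis 1, √-d.

F : Set
F = ℚ × ℚ

ℤ→ℚ : ℤ → ℚ
ℤ→ℚ m = m / 1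

ℕ→ℚ : ℕ → ℚ
ℕ→ℚ m = (+ m) / 1

_⊕_ : F → F → F
(a , b) ⊕ (c , e) = (a + c , b + e)

_⊖_ : F → F → F
(a , b) ⊖ (c , e) = (a - c , b - e)

_·_ : ℚ → F → F
q · (a , b) = (q * a , q * b)

mulF : ℕ → F → F → F
mulF d (a , b) (c , e) = (a * c - ℕ→ℚ d * (b * e) , a * e + b * c)

normF : ℕ → F → ℚ
normF d (a , b) = a * a + ℕ→ℚ d * (b * b)

-- ℚ-linear endomorphisms of F (2×2 rational matrices w.r.t. 1, √-d)

record Mat : Set where
  constructor mat
  field
    m11 m12 m21 m22 : ℚ

apply : Mat → F → F
apply (mat p q r s) (a , b) = (p * a + q * b , r * a + s * b)

compose : Mat → Mat → Mat
compose (mat p q r s) (mat p' q' r' s') =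
  mat (p * p' + q * r') (p * q' + q * s') (r * p' + s * r') (r * q' + s * s')

idMat : Mat
idMat = mat 1ℚ 0ℚ 0ℚ 1ℚ

det : Mat → ℚ
det (mat p q r s) = p * s - q * r

power : Mat → ℕ → Mat
power σ 0 = idMat
power σ (suc k) = compose σ (power σ k)

InO : ℕ → Mat → Set
InO d σ = ∀ v → normF d (apply σ v) ≡ normF d v

InO⁺ : ℕ → Mat → Set
InO⁺ d σ = InO d σ × det σ ≡ 1ℚ

FiniteOrder : Mat → Set
FiniteOrder ρ = Σ ℕ λ k → power ρ (suc k) ≡ idMat

record Lattice : Set where
  constructor lattice
  field
    e₁ e₂ : F
    indep : ¬ (det (mat (Data.Product.proj₁ e₁) (Data.Product.proj₁ e₂)
                        (Data.Product.proj₂ e₁) (Data.Product.proj₂ e₂)) ≡ 0ℚ)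

open Lattice public

_∈L_ : F → Lattice → Set
v ∈L L = Σ ℤ λ m → Σ ℤ λ n → v ≡ (ℤ→ℚ m · e₁ L) ⊕ (ℤ→ℚ n · e₂ L)

_⊆L_ : Lattice → Lattice → Set
K ⊆L L = ∀ v → v ∈L K → v ∈L L

_≐L_ : Lattice → Lattice → Set
K ≐L L = (K ⊆L L) × (L ⊆L K)

ImageIn : Mat → Lattice → Lattice → Set
ImageIn σ K L = ∀ v → v ∈L K → apply σ v ∈L L

Stable : Mat → Lattice → Set
Stable ρ K = ImageIn ρ K K × (∀ v → v ∈L K → Σ F λ w → w ∈L K × apply ρ w ≡ v)

-- Finite cardinalities: "the set {a | P a}, taken modulo the equivalence
-- _≈_, has exactly n elements" (witnessed by a duplicate-free complete list).

HasCard : {A : Set} → (A → Set) → (A → A → Set) → ℕ → Set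
HasCard {A} P _≈_ n =
  Σ (List A) λ xs →
    length xs ≡ n × All P xs × (∀ a → P a → Any (a ≈_) xs)
      × AllPairs (λ x y → ¬ (x ≈ y)) xs

HasIndex : Lattice → Lattice → ℕ → Set
HasIndex L K n = HasCard (λ v → v ∈L L) (λ v w → (v ⊖ w) ∈L K) n

-- Coefficients of the Dirichlet series
--   Z_{L,ρ}(s) = Σ_{K ⊆ L, |L:K|<∞, ρK = K} |L:K|^{-s} / #{σ ∈ G : σK ⊆ L}
-- for G = O(F) or O⁺(F) (given by the predicate inG).
-- ZCoeff inG L ρ n c  means: the coefficient of n^{-s} equals c, i.e.
-- c = Σ_{K ⊆ L, |L:K| = n, ρK = K} 1 / #{σ ∈ G : σ(K) ⊆ L}.

Counted : (Mat → Set) → Lattice → Mat → ℕ → Lattice → Set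
Counted inG L ρ n K = (K ⊆L L) × HasIndex L K n × Stable ρ K

sumℚ : List ℚ → ℚ
sumℚ = foldr _+_ 0ℚ

ZCoeff : (Mat → Set) → Lattice → Mat → ℕ → ℚ → Set
ZCoeff inG L ρ n c =
  Σ (List Lattice) λ Ks →
    All (Counted inG L ρ n) Ks
    × (∀ K → Counted inG L ρ n K → Any (K ≐L_) Ks)
    × AllPairs (λ K K' → ¬ (K ≐L K')) Ks
    × Σ (List ℚ) λ ws →
        Pointwise (λ K w → Σ ℕ λ m →
                     HasCard (λ σ → inG σ × ImageIn σ K L) _≡_ m
                     × w * ℕ→ℚ m ≡ 1ℚ) Ks ws
        × c ≡ sumℚ ws

1F : F
1F = (1ℚ , 0ℚ)

1≢0 : ¬ (det (mat 1ℚ 0ℚ 0ℚ 1ℚ) ≡ 0ℚ)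
1≢0 ()

½≢0 : ¬ (det (mat 1ℚ ½ 0ℚ ½) ≡ 0ℚ)
½≢0 ()

ringOfIntegers : ℕ → Lattice
ringOfIntegers 1 = lattice 1F (0ℚ , 1ℚ) 1≢0
ringOfIntegers _ = lattice 1F (½ , ½) ½≢0

-- a fractional ideal: a (nonzero, finitely generated) R-submodule of F,
-- i.e. a full ℤ-lattice on F stable under multiplication by R
IsFractionalIdeal : ℕ → Lattice → Set
IsFractionalIdeal d I = ∀ r v → r ∈L ringOfIntegers d → v ∈L I → mulF d r v ∈L I

module Submission where

-- R is Euclidean for the norm, so every fractional ideal is principal: I = αR with α = g/N, where
-- N is a common denominator of a basis e₁, e₂ of I and g = gcd(N e₁, N e₂) in R. Elements of
-- O⁺(F) are multiplications by elements of norm 1, so multiplication by α commutes with ρ; it maps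
-- the ρ-stable sublattices of R of index n bijectively onto those of I, and conjugation by it maps
-- {σ ∈ O(F) : σK ⊆ R} onto {σ ∈ O(F) : σ(αK) ⊆ I}. Hence Z_{I,ρ} = Z_{R,ρ}. Complex conjugation c
-- preserves R and O(F) = O⁺(F) ⊔ c O⁺(F), so each term of Z_{R,ρ} has exactly twice as many
-- isometries in its denominator as the corresponding term of Z⁺_{R,ρ}.
--
-- All sums and counts are finite: a sublattice of index n has a Hermite normal form with entries
-- below n, and if (1+M)·1 ∈ K then every σ ∈ O⁺(F) with σK ⊆ R ⊆ ½ℤ² is multiplication by
-- (i + j√-d)/(2+2M) with |i|, |j| ≤ 2+2M.

open import Defs
open import Data.Nat using (ℕ; _≤_)
open import Data.Rational using (ℚ; ½; _*_)
open import Data.Product using (Σ; _×_)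
open import Data.Sum using (_⊎_)
open import Relation.Binary.PropositionalEquality using (_≡_)

open import Level using (0ℓ)
open import Function using (id; _∘_)
open import Data.Empty using (⊥-elim)
open import Data.Nat using (zero; suc; _<_; _⊔_; NonZero; z≤n; s≤s)
import Data.Nat as ℕ
import Data.Nat.Properties as ℕ
open import Data.Nat.Divisibility using (divides; m∣m*n; n∣m*n; ∣-trans) renaming (_∣_ to _∣ℕ_)
open import Data.Nat.Induction using (<-wellFounded)
import Data.Nat.Coprimality as Coprimality
open import Data.Integer using (ℤ; +_; -[1+_])
import Data.Integer as ℤ
import Data.Integer.Properties as ℤ
open import Data.Integer.DivMod using (_%ℕ_; _/ℕ_; n%ℕd<d; a≡a%ℕn+[a/ℕn]*n)
open import Data.Rational using (mkℚ; _+_; _-_; -_; 0ℚ; 1ℚ; _≟_; toℚᵘ; ↥_; ↧_; ↧ₙ_)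
import Data.Rational as ℚ
import Data.Rational.Properties as ℚ
import Data.Rational.Unnormalised as ℚᵘ
import Data.Rational.Unnormalised.Properties as ℚᵘ
open import Data.Product using (∃; ∃₂; _,_; proj₁; proj₂)
open import Data.Sum using (inj₁; inj₂)
open import Data.List using (List; []; _∷_; _++_; map; length; filter; deduplicate; downFrom; cartesianProduct)
open import Data.List.Properties using (length-removeAt′; length-downFrom; length-++; length-map)
open import Data.List.Membership.Propositional using (_∈_)
import Data.List.Membership.Propositional.Properties as ∈
open import Data.List.Membership.Setoid.Properties using (∈-filter⁺; ∈-deduplicate⁺)
open import Data.List.Relation.Binary.Pointwise using (Pointwise; []; _∷_)
open import Data.List.Relation.Unary.All as All using (All; []; _∷_)
import Data.List.Relation.Unary.All.Properties as All
open import Data.List.Relation.Unary.Any as Any using (Any; here; there; _─_)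
import Data.List.Relation.Unary.Any.Properties as Any
open import Data.List.Relation.Unary.AllPairs as AllPairs using (AllPairs; []; _∷_)
import Data.List.Relation.Unary.AllPairs.Properties as AllPairs
import Data.List.Relation.Unary.Unique.Setoid.Properties as Unique
import Data.List.Relation.Unary.Unique.Propositional.Properties as Unique≡
open import Data.List.Relation.Unary.Unique.DecSetoid.Properties using (deduplicate-!)
open import Induction.WellFounded using (Acc; acc)
open import Relation.Nullary using (¬_; Dec; yes; no)
open import Relation.Nullary.Decidable using (dec⇒maybe; _×-dec_; map′)
open import Relation.Unary using (Decidable)
open import Relation.Binary using (IsDecEquivalence; DecSetoid; _Respects_)
open import Relation.Binary.PropositionalEquality
  using (refl; sym; trans; cong; cong₂; subst; module ≡-Reasoning; decSetoid)
open import Tactic.RingSolver using (solve-∀)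
open import Tactic.RingSolver.Core.AlmostCommutativeRing using (AlmostCommutativeRing; fromCommutativeRing)
import Data.Integer.Tactic.RingSolver as ℤ-Solver
import Data.Nat.Tactic.RingSolver as ℕ-Solver

-- Arithmetic in ℕ, ℤ and ℚ

ℚ-ring : AlmostCommutativeRing 0ℓ 0ℓ
ℚ-ring = fromCommutativeRing ℚ.+-*-commutativeRing (λ x → dec⇒maybe (0ℚ ℚ.≟ x))

least-witness : ∀ {P : ℕ → Set} → Decidable P → ∀ {n} → P n → ∃ λ m → P m × (∀ {k} → k < m → ¬ P k)
least-witness {P} P? = search (<-wellFounded _)
  where
  search : ∀ {n} → Acc _<_ n → P n → ∃ λ m → P m × (∀ {k} → k < m → ¬ P k)
  search {n} (acc smaller) Pn with ℕ.anyUpTo? P? n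
  ... | yes (k , k<n , Pk) = search (smaller k<n) Pk
  ... | no ¬below          = n , Pn , λ k<n Pk → ¬below (_ , k<n , Pk)

x-y≡t*r⇒t≡0 : ∀ {x y r} t → x < r → y < r → + x ℤ.- + y ≡ t ℤ.* + r → t ≡ + 0
x-y≡t*r⇒t≡0 {x} {y} {r} t x<r y<r x-y≡tr with t ℤ.≟ + 0
... | yes t≡0 = t≡0
... | no  t≢0 = ⊥-elim (ℕ.<-irrefl refl (begin-strict
  r                       ≤⟨ ℕ.m≤n*m r ℤ.∣ t ∣ {{ℤ.≢-nonZero t≢0}} ⟩
  ℤ.∣ t ∣ ℕ.* r           ≡⟨ sym (ℤ.abs-* t (+ r)) ⟩
  ℤ.∣ t ℤ.* + r ∣         ≡⟨ cong ℤ.∣_∣ (sym x-y≡tr) ⟩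
  ℤ.∣ + x ℤ.- + y ∣       ≡⟨ cong ℤ.∣_∣ (ℤ.m-n≡m⊖n x y) ⟩
  ℤ.∣ x ℤ.⊖ y ∣           ≤⟨ ℤ.∣m⊝n∣≤m⊔n x y ⟩
  x ⊔ y                   <⟨ ℕ.⊔-lub x<r y<r ⟩
  r                       ∎))
  where open ℕ.≤-Reasoning

a≡b+c⇒a-b≡c : ∀ a b c → a ≡ b ℤ.+ c → a ℤ.- b ≡ c
a≡b+c⇒a-b≡c a b c a≡b+c = begin
  a ℤ.- b              ≡⟨ cong (ℤ._- b) a≡b+c ⟩
  (b ℤ.+ c) ℤ.- b      ≡⟨ identity b c ⟩
  c                    ∎
  where
  open ≡-Reasoning
  identity : ∀ b c → (b ℤ.+ c) ℤ.- b ≡ c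
  identity = ℤ-Solver.solve-∀

m*m≤n*n⇒m≤n : ∀ m n → m ℕ.* m ≤ n ℕ.* n → m ≤ n
m*m≤n*n⇒m≤n m n m²≤n² with m ℕ.≤? n
... | yes m≤n = m≤n
... | no  m≰n = ⊥-elim (ℕ.<⇒≱ (ℕ.*-mono-< (ℕ.≰⇒> m≰n) (ℕ.≰⇒> m≰n)) m²≤n²)

i*i≡∣i∣*∣i∣ : ∀ i → i ℤ.* i ≡ + (ℤ.∣ i ∣ ℕ.* ℤ.∣ i ∣)
i*i≡∣i∣*∣i∣ (+ n)      = sym (ℤ.pos-* n n)
i*i≡∣i∣*∣i∣ -[1+ n ]   = refl

sum-of-squares : ∀ s c n → s ℤ.* s ℤ.+ + c ℤ.* (n ℤ.* n) ≡ + (ℤ.∣ s ∣ ℕ.* ℤ.∣ s ∣ ℕ.+ c ℕ.* (ℤ.∣ n ∣ ℕ.* ℤ.∣ n ∣))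
sum-of-squares s c n = begin
  s ℤ.* s ℤ.+ + c ℤ.* (n ℤ.* n)        ≡⟨ cong₂ (λ x y → x ℤ.+ + c ℤ.* y) (i*i≡∣i∣*∣i∣ s) (i*i≡∣i∣*∣i∣ n) ⟩
  + S ℤ.+ + c ℤ.* + N                  ≡⟨ cong (λ x → + S ℤ.+ x) (ℤ.pos-* c N) ⟨
  + S ℤ.+ + (c ℕ.* N)                  ≡⟨ ℤ.pos-+ S (c ℕ.* N) ⟨
  + (S ℕ.+ c ℕ.* N)                    ∎
  where
  open ≡-Reasoning
  S = ℤ.∣ s ∣ ℕ.* ℤ.∣ s ∣
  N = ℤ.∣ n ∣ ℕ.* ℤ.∣ n ∣

4*n≤3*m⇒n<m : ∀ n m .{{_ : NonZero m}} → 4 ℕ.* n ≤ 3 ℕ.* m → n < m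
4*n≤3*m⇒n<m n m 4n≤3m = ℕ.*-cancelˡ-< 4 n m (ℕ.≤-<-trans 4n≤3m (ℕ.*-monoˡ-< m (ℕ.n<1+n 3)))

ℤ→ℚ≡mkℚ : ∀ m → ℤ→ℚ m ≡ mkℚ m 0 (Coprimality.sym (Coprimality.1-coprimeTo ℤ.∣ m ∣))
ℤ→ℚ≡mkℚ m = ℚ.↥p/↧p≡p (mkℚ m 0 _)

toℚᵘ-ℤ→ℚ : ∀ m → toℚᵘ (ℤ→ℚ m) ≡ ℚᵘ.mkℚᵘ m 0
toℚᵘ-ℤ→ℚ m rewrite ℤ→ℚ≡mkℚ m = refl

ℤ→ℚ-injective : ∀ {a b} → ℤ→ℚ a ≡ ℤ→ℚ b → a ≡ b
ℤ→ℚ-injective {a} {b} e = cong ↥_ (trans (sym (ℤ→ℚ≡mkℚ a)) (trans e (ℤ→ℚ≡mkℚ b)))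

ℤ→ℚ-+ : ∀ a b → ℤ→ℚ (a ℤ.+ b) ≡ ℤ→ℚ a + ℤ→ℚ b
ℤ→ℚ-+ a b = ℚ.toℚᵘ-injective (begin-equality
  toℚᵘ (ℤ→ℚ (a ℤ.+ b))                        ≡⟨ toℚᵘ-ℤ→ℚ (a ℤ.+ b) ⟩
  ℚᵘ.mkℚᵘ (a ℤ.+ b) 0                         ≃⟨ ℚᵘ.*≡* (identity a b) ⟩
  ℚᵘ.mkℚᵘ a 0 ℚᵘ.+ ℚᵘ.mkℚᵘ b 0                ≡⟨ sym (cong₂ ℚᵘ._+_ (toℚᵘ-ℤ→ℚ a) (toℚᵘ-ℤ→ℚ b)) ⟩
  toℚᵘ (ℤ→ℚ a) ℚᵘ.+ toℚᵘ (ℤ→ℚ b)              ≃⟨ ℚᵘ.≃-sym (ℚ.toℚᵘ-homo-+ (ℤ→ℚ a) (ℤ→ℚ b)) ⟩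
  toℚᵘ (ℤ→ℚ a + ℤ→ℚ b)                        ∎)
  where
  open ℚᵘ.≤-Reasoning
  identity : ∀ a b → (a ℤ.+ b) ℤ.* + 1 ≡ (a ℤ.* + 1 ℤ.+ b ℤ.* + 1) ℤ.* + 1
  identity = ℤ-Solver.solve-∀

ℤ→ℚ-* : ∀ a b → ℤ→ℚ (a ℤ.* b) ≡ ℤ→ℚ a * ℤ→ℚ b
ℤ→ℚ-* a b = ℚ.toℚᵘ-injective (begin-equality
  toℚᵘ (ℤ→ℚ (a ℤ.* b))                        ≡⟨ toℚᵘ-ℤ→ℚ (a ℤ.* b) ⟩
  ℚᵘ.mkℚᵘ (a ℤ.* b) 0                         ≡⟨⟩
  ℚᵘ.mkℚᵘ a 0 ℚᵘ.* ℚᵘ.mkℚᵘ b 0                ≡⟨ sym (cong₂ ℚᵘ._*_ (toℚᵘ-ℤ→ℚ a) (toℚᵘ-ℤ→ℚ b)) ⟩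
  toℚᵘ (ℤ→ℚ a) ℚᵘ.* toℚᵘ (ℤ→ℚ b)              ≃⟨ ℚᵘ.≃-sym (ℚ.toℚᵘ-homo-* (ℤ→ℚ a) (ℤ→ℚ b)) ⟩
  toℚᵘ (ℤ→ℚ a * ℤ→ℚ b)                        ∎)
  where open ℚᵘ.≤-Reasoning

ℤ→ℚ-neg : ∀ a → ℤ→ℚ (ℤ.- a) ≡ - ℤ→ℚ a
ℤ→ℚ-neg a = ℚ.toℚᵘ-injective (begin-equality
  toℚᵘ (ℤ→ℚ (ℤ.- a))           ≡⟨ toℚᵘ-ℤ→ℚ (ℤ.- a) ⟩
  ℚᵘ.- ℚᵘ.mkℚᵘ a 0             ≡⟨ cong ℚᵘ.-_ (sym (toℚᵘ-ℤ→ℚ a)) ⟩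
  ℚᵘ.- toℚᵘ (ℤ→ℚ a)            ≃⟨ ℚᵘ.≃-sym (ℚ.toℚᵘ-homo‿- (ℤ→ℚ a)) ⟩
  toℚᵘ (- ℤ→ℚ a)               ∎)
  where open ℚᵘ.≤-Reasoning

ℤ→ℚ-minus : ∀ a b → ℤ→ℚ (a ℤ.- b) ≡ ℤ→ℚ a - ℤ→ℚ b
ℤ→ℚ-minus a b = trans (ℤ→ℚ-+ a (ℤ.- b)) (cong (λ x → ℤ→ℚ a + x) (ℤ→ℚ-neg b))

IsInteger : ℚ → Set
IsInteger q = Σ ℤ λ m → q ≡ ℤ→ℚ m

isInteger? : ∀ q → Dec (IsInteger q)
isInteger? (mkℚ m zero _)    = yes (m , sym (ℤ→ℚ≡mkℚ m))
isInteger? (mkℚ m (suc k) _) = no λ (z , e) → ℕ.1+n≢0 (cong ℚ.ℚ.denominator-1 (trans e (ℤ→ℚ≡mkℚ z)))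

ℤ→ℚ-lincomb : ∀ a m b n → ℤ→ℚ (a ℤ.* m ℤ.+ b ℤ.* n) ≡ ℤ→ℚ a * ℤ→ℚ m + ℤ→ℚ b * ℤ→ℚ n
ℤ→ℚ-lincomb a m b n = trans (ℤ→ℚ-+ (a ℤ.* m) (b ℤ.* n)) (cong₂ _+_ (ℤ→ℚ-* a m) (ℤ→ℚ-* b n))

ℕ→ℚ-+ : ∀ m n → ℕ→ℚ (m ℕ.+ n) ≡ ℕ→ℚ m + ℕ→ℚ n
ℕ→ℚ-+ m n = trans (cong ℤ→ℚ (ℤ.pos-+ m n)) (ℤ→ℚ-+ (+ m) (+ n))

*-cancelˡ : ∀ {c x y} → ¬ c ≡ 0ℚ → c * x ≡ c * y → x ≡ y
*-cancelˡ {c} {x} {y} c≢0 cx≡cy = begin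
  x                ≡⟨ sym (ℚ.*-identityˡ x) ⟩
  1ℚ * x           ≡⟨ cong (_* x) (sym c⁻¹*c≡1) ⟩
  (c⁻¹ * c) * x    ≡⟨ ℚ.*-assoc c⁻¹ c x ⟩
  c⁻¹ * (c * x)    ≡⟨ cong (c⁻¹ *_) cx≡cy ⟩
  c⁻¹ * (c * y)    ≡⟨ ℚ.*-assoc c⁻¹ c y ⟨
  (c⁻¹ * c) * y    ≡⟨ cong (_* y) c⁻¹*c≡1 ⟩
  1ℚ * y           ≡⟨ ℚ.*-identityˡ y ⟩
  y                ∎
  where
  open ≡-Reasoning
  c⁻¹ = ℚ.1/_ c {{ℚ.≢-nonZero c≢0}}
  c⁻¹*c≡1 : c⁻¹ * c ≡ 1ℚ
  c⁻¹*c≡1 = ℚ.*-inverseˡ c {{ℚ.≢-nonZero c≢0}}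

*≡0⇒≡0 : ∀ {x y} → ¬ x ≡ 0ℚ → x * y ≡ 0ℚ → y ≡ 0ℚ
*≡0⇒≡0 {x} x≢0 xy≡0 = *-cancelˡ x≢0 (trans xy≡0 (sym (ℚ.*-zeroʳ x)))

*-≢0 : ∀ {x y} → ¬ x ≡ 0ℚ → ¬ y ≡ 0ℚ → ¬ x * y ≡ 0ℚ
*-≢0 x≢0 y≢0 = y≢0 ∘ *≡0⇒≡0 x≢0

x*x≡1⇒x≡±1 : ∀ x → x * x ≡ 1ℚ → x ≡ 1ℚ ⊎ x ≡ - 1ℚ
x*x≡1⇒x≡±1 x x²≡1 with x ℚ.≟ 1ℚ
... | yes x≡1 = inj₁ x≡1
... | no  x≢1 = inj₂ (trans (plus-minus x) (cong (_- 1ℚ) x+1≡0))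
  where
  plus-minus : ∀ x → x ≡ (x + 1ℚ) - 1ℚ
  plus-minus = solve-∀ ℚ-ring
  minus-plus : ∀ x → x ≡ (x - 1ℚ) + 1ℚ
  minus-plus = solve-∀ ℚ-ring
  factor : ∀ x → (x - 1ℚ) * (x + 1ℚ) ≡ x * x - 1ℚ
  factor = solve-∀ ℚ-ring
  x-1≢0 : ¬ x - 1ℚ ≡ 0ℚ
  x-1≢0 x-1≡0 = x≢1 (trans (minus-plus x) (cong (_+ 1ℚ) x-1≡0))
  x+1≡0 : x + 1ℚ ≡ 0ℚ
  x+1≡0 = *≡0⇒≡0 x-1≢0 (trans (factor x) (cong (_- 1ℚ) x²≡1))

ℤ→ℚ-suc≢0 : ∀ k → ¬ ℤ→ℚ (+ suc k) ≡ 0ℚ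
ℤ→ℚ-suc≢0 k e with ℤ→ℚ-injective {+ suc k} {+ 0} e
... | ()

denominator-clears : ∀ q → ℤ→ℚ (↧ q) * q ≡ ℤ→ℚ (↥ q)
denominator-clears q@(mkℚ n d-1 _) = ℚ.toℚᵘ-injective (begin-equality
  toℚᵘ (ℤ→ℚ (↧ q) * q)                        ≃⟨ ℚ.toℚᵘ-homo-* (ℤ→ℚ (↧ q)) q ⟩
  toℚᵘ (ℤ→ℚ (↧ q)) ℚᵘ.* toℚᵘ q                ≡⟨ cong (ℚᵘ._* toℚᵘ q) (toℚᵘ-ℤ→ℚ (↧ q)) ⟩
  ℚᵘ.mkℚᵘ (↧ q) 0 ℚᵘ.* ℚᵘ.mkℚᵘ n d-1          ≃⟨ ℚᵘ.*≡* (identity (↧ q) n) ⟩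
  ℚᵘ.mkℚᵘ n 0                                 ≡⟨ toℚᵘ-ℤ→ℚ n ⟨
  toℚᵘ (ℤ→ℚ n)                                ∎)
  where
  open ℚᵘ.≤-Reasoning
  identity : ∀ D n → (D ℤ.* n) ℤ.* + 1 ≡ n ℤ.* (+ 1 ℤ.* D)
  identity = ℤ-Solver.solve-∀

multiple-of-denominator : ∀ q m → ↧ₙ q ∣ℕ m → IsInteger (ℤ→ℚ (+ m) * q)
multiple-of-denominator q m (divides k refl) = + k ℤ.* ↥ q , (begin
  ℤ→ℚ (+ (k ℕ.* ↧ₙ q)) * q           ≡⟨ cong (λ z → ℤ→ℚ z * q) (ℤ.pos-* k (↧ₙ q)) ⟩
  ℤ→ℚ (+ k ℤ.* ↧ q) * q              ≡⟨ cong (_* q) (ℤ→ℚ-* (+ k) (↧ q)) ⟩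
  ℤ→ℚ (+ k) * ℤ→ℚ (↧ q) * q          ≡⟨ ℚ.*-assoc (ℤ→ℚ (+ k)) (ℤ→ℚ (↧ q)) q ⟩
  ℤ→ℚ (+ k) * (ℤ→ℚ (↧ q) * q)        ≡⟨ cong (ℤ→ℚ (+ k) *_) (denominator-clears q) ⟩
  ℤ→ℚ (+ k) * ℤ→ℚ (↥ q)              ≡⟨ ℤ→ℚ-* (+ k) (↥ q) ⟨
  ℤ→ℚ (+ k ℤ.* ↥ q)                  ∎)
  where open ≡-Reasoning

-- Lattices

point : Lattice → ℤ → ℤ → F
point L m n = (ℤ→ℚ m · e₁ L) ⊕ (ℤ→ℚ n · e₂ L)

basisDet : F → F → ℚ
basisDet (a₁ , b₁) (a₂ , b₂) = det (mat a₁ a₂ b₁ b₂)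

latticeDet : Lattice → ℚ
latticeDet L = basisDet (e₁ L) (e₂ L)

latticeDet⁻¹ : Lattice → ℚ
latticeDet⁻¹ L = ℚ.1/_ (latticeDet L) {{ℚ.≢-nonZero (indep L)}}

latticeDet*latticeDet⁻¹ : ∀ L → latticeDet L * latticeDet⁻¹ L ≡ 1ℚ
latticeDet*latticeDet⁻¹ L = ℚ.*-inverseʳ (latticeDet L) {{ℚ.≢-nonZero (indep L)}}

coord₁ coord₂ : Lattice → F → ℚ
coord₁ L (x , y) = (x * proj₂ (e₂ L) - proj₁ (e₂ L) * y) * latticeDet⁻¹ L
coord₂ L (x , y) = (proj₁ (e₁ L) * y - x * proj₂ (e₁ L)) * latticeDet⁻¹ L

-- Cramer's rule, with t standing for the inverse of the determinant.
cramer : ∀ a₁ b₁ a₂ b₂ x y t → (a₁ * b₂ - a₂ * b₁) * t ≡ 1ℚ →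
  ((x * b₂ - a₂ * y) * t) * a₁ + ((a₁ * y - x * b₁) * t) * a₂ ≡ x ×
  ((x * b₂ - a₂ * y) * t) * b₁ + ((a₁ * y - x * b₁) * t) * b₂ ≡ y
cramer a₁ b₁ a₂ b₂ x y t Δt≡1 =
  trans (first a₁ b₁ a₂ b₂ x y t) (scaled x) , trans (second a₁ b₁ a₂ b₂ x y t) (scaled y)
  where
  scaled : ∀ z → z * ((a₁ * b₂ - a₂ * b₁) * t) ≡ z
  scaled z = trans (cong (z *_) Δt≡1) (ℚ.*-identityʳ z)
  first : ∀ a₁ b₁ a₂ b₂ x y t →
    ((x * b₂ - a₂ * y) * t) * a₁ + ((a₁ * y - x * b₁) * t) * a₂ ≡ x * ((a₁ * b₂ - a₂ * b₁) * t)
  first = solve-∀ ℚ-ring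
  second : ∀ a₁ b₁ a₂ b₂ x y t →
    ((x * b₂ - a₂ * y) * t) * b₁ + ((a₁ * y - x * b₁) * t) * b₂ ≡ y * ((a₁ * b₂ - a₂ * b₁) * t)
  second = solve-∀ ℚ-ring

coords-decomposition : ∀ L v → v ≡ (coord₁ L v · e₁ L) ⊕ (coord₂ L v · e₂ L)
coords-decomposition L@(lattice (a₁ , b₁) (a₂ , b₂) _) (x , y) =
  let c₁ , c₂ = cramer a₁ b₁ a₂ b₂ x y (latticeDet⁻¹ L) (latticeDet*latticeDet⁻¹ L)
  in sym (cong₂ _,_ c₁ c₂)

coords-point : ∀ L m n → coord₁ L (point L m n) ≡ ℤ→ℚ m × coord₂ L (point L m n) ≡ ℤ→ℚ n
coords-point L@(lattice (a₁ , b₁) (a₂ , b₂) _) m n =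
  trans (first a₁ b₁ a₂ b₂ (ℤ→ℚ m) (ℤ→ℚ n) t) (scaled (ℤ→ℚ m)) ,
  trans (second a₁ b₁ a₂ b₂ (ℤ→ℚ m) (ℤ→ℚ n) t) (scaled (ℤ→ℚ n))
  where
  t = latticeDet⁻¹ L
  scaled : ∀ z → z * ((a₁ * b₂ - a₂ * b₁) * t) ≡ z
  scaled z = trans (cong (z *_) (latticeDet*latticeDet⁻¹ L)) (ℚ.*-identityʳ z)
  first : ∀ a₁ b₁ a₂ b₂ m n t →
    ((m * a₁ + n * a₂) * b₂ - a₂ * (m * b₁ + n * b₂)) * t ≡ m * ((a₁ * b₂ - a₂ * b₁) * t)
  first = solve-∀ ℚ-ring
  second : ∀ a₁ b₁ a₂ b₂ m n t →
    (a₁ * (m * b₁ + n * b₂) - (m * a₁ + n * a₂) * b₁) * t ≡ n * ((a₁ * b₂ - a₂ * b₁) * t)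
  second = solve-∀ ℚ-ring

point-injective : ∀ L {a b a′ b′} → point L a b ≡ point L a′ b′ → a ≡ a′ × b ≡ b′
point-injective L {a} {b} {a′} {b′} e =
  ℤ→ℚ-injective (trans (sym (proj₁ (coords-point L a b))) (trans (cong (coord₁ L) e) (proj₁ (coords-point L a′ b′)))) ,
  ℤ→ℚ-injective (trans (sym (proj₂ (coords-point L a b))) (trans (cong (coord₂ L) e) (proj₂ (coords-point L a′ b′))))

_∈L?_ : ∀ v L → Dec (v ∈L L)
v ∈L? L with isInteger? (coord₁ L v) | isInteger? (coord₂ L v)
... | yes (m , c₁≡m) | yes (n , c₂≡n) =
  yes (m , n , trans (coords-decomposition L v) (cong₂ (λ a b → (a · e₁ L) ⊕ (b · e₂ L)) c₁≡m c₂≡n))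
... | no ¬int | _      = no λ (m , n , v≡) → ¬int (m , trans (cong (coord₁ L) v≡) (proj₁ (coords-point L m n)))
... | yes _ | no ¬int  = no λ (m , n , v≡) → ¬int (n , trans (cong (coord₂ L) v≡) (proj₂ (coords-point L m n)))

point-lincomb : ∀ L a m₁ n₁ b m₂ n₂ →
  (ℤ→ℚ a · point L m₁ n₁) ⊕ (ℤ→ℚ b · point L m₂ n₂) ≡ point L (a ℤ.* m₁ ℤ.+ b ℤ.* m₂) (a ℤ.* n₁ ℤ.+ b ℤ.* n₂)
point-lincomb L a m₁ n₁ b m₂ n₂ = cong₂ _,_ (component (proj₁ (e₁ L)) (proj₁ (e₂ L))) (component (proj₂ (e₁ L)) (proj₂ (e₂ L)))
  where
  identity : ∀ a m₁ n₁ b m₂ n₂ x y →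
    a * (m₁ * x + n₁ * y) + b * (m₂ * x + n₂ * y) ≡ (a * m₁ + b * m₂) * x + (a * n₁ + b * n₂) * y
  identity = solve-∀ ℚ-ring
  component : ∀ x y →
    ℤ→ℚ a * (ℤ→ℚ m₁ * x + ℤ→ℚ n₁ * y) + ℤ→ℚ b * (ℤ→ℚ m₂ * x + ℤ→ℚ n₂ * y)
      ≡ ℤ→ℚ (a ℤ.* m₁ ℤ.+ b ℤ.* m₂) * x + ℤ→ℚ (a ℤ.* n₁ ℤ.+ b ℤ.* n₂) * y
  component x y = trans (identity (ℤ→ℚ a) (ℤ→ℚ m₁) (ℤ→ℚ n₁) (ℤ→ℚ b) (ℤ→ℚ m₂) (ℤ→ℚ n₂) x y)
    (sym (cong₂ (λ c e → c * x + e * y) (ℤ→ℚ-lincomb a m₁ b m₂) (ℤ→ℚ-lincomb a n₁ b n₂)))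

∈L-lincomb : ∀ L {u v} → u ∈L L → v ∈L L → ∀ a b → ((ℤ→ℚ a · u) ⊕ (ℤ→ℚ b · v)) ∈L L
∈L-lincomb L (m₁ , n₁ , refl) (m₂ , n₂ , refl) a b =
  a ℤ.* m₁ ℤ.+ b ℤ.* m₂ , a ℤ.* n₁ ℤ.+ b ℤ.* n₂ , point-lincomb L a m₁ n₁ b m₂ n₂

∈L-e₁ : ∀ L → e₁ L ∈L L
∈L-e₁ L = + 1 , + 0 , cong₂ _,_ (identity (proj₁ (e₁ L)) (proj₁ (e₂ L))) (identity (proj₂ (e₁ L)) (proj₂ (e₂ L)))
  where
  identity : ∀ x y → x ≡ 1ℚ * x + 0ℚ * y
  identity = solve-∀ ℚ-ring

∈L-e₂ : ∀ L → e₂ L ∈L L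
∈L-e₂ L = + 0 , + 1 , cong₂ _,_ (identity (proj₁ (e₁ L)) (proj₁ (e₂ L))) (identity (proj₂ (e₁ L)) (proj₂ (e₂ L)))
  where
  identity : ∀ x y → y ≡ 0ℚ * x + 1ℚ * y
  identity = solve-∀ ℚ-ring

∈L-⊕ : ∀ L {u v} → u ∈L L → v ∈L L → (u ⊕ v) ∈L L
∈L-⊕ L {u₁ , u₂} {v₁ , v₂} u∈L v∈L =
  subst (_∈L L) (cong₂ _,_ (identity u₁ v₁) (identity u₂ v₂)) (∈L-lincomb L u∈L v∈L (+ 1) (+ 1))
  where
  identity : ∀ x y → 1ℚ * x + 1ℚ * y ≡ x + y
  identity = solve-∀ ℚ-ring

∈L-⊖ : ∀ L {u v} → u ∈L L → v ∈L L → (u ⊖ v) ∈L L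
∈L-⊖ L {u₁ , u₂} {v₁ , v₂} u∈L v∈L =
  subst (_∈L L) (cong₂ _,_ (identity u₁ v₁) (identity u₂ v₂)) (∈L-lincomb L u∈L v∈L (+ 1) (ℤ.- + 1))
  where
  identity : ∀ x y → 1ℚ * x + - 1ℚ * y ≡ x - y
  identity = solve-∀ ℚ-ring

∈L-0 : ∀ L → (0ℚ , 0ℚ) ∈L L
∈L-0 L = + 0 , + 0 , cong₂ _,_ (identity (proj₁ (e₁ L)) (proj₁ (e₂ L))) (identity (proj₂ (e₁ L)) (proj₂ (e₂ L)))
  where
  identity : ∀ x y → 0ℚ ≡ 0ℚ * x + 0ℚ * y
  identity = solve-∀ ℚ-ring

⊖-self : ∀ v → v ⊖ v ≡ (0ℚ , 0ℚ)
⊖-self (x , y) = cong₂ _,_ (ℚ.+-inverseʳ x) (ℚ.+-inverseʳ y)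

⊖-antisym : ∀ u v → (v ⊖ u) ≡ (0ℚ , 0ℚ) ⊖ (u ⊖ v)
⊖-antisym (u₁ , u₂) (v₁ , v₂) = cong₂ _,_ (identity u₁ v₁) (identity u₂ v₂)
  where
  identity : ∀ x y → y - x ≡ 0ℚ - (x - y)
  identity = solve-∀ ℚ-ring

⊖-trans : ∀ u v w → (u ⊖ w) ≡ (u ⊖ v) ⊕ (v ⊖ w)
⊖-trans (u₁ , u₂) (v₁ , v₂) (w₁ , w₂) = cong₂ _,_ (identity u₁ v₁ w₁) (identity u₂ v₂ w₂)
  where
  identity : ∀ x y z → x - z ≡ (x - y) + (y - z)
  identity = solve-∀ ℚ-ring

⊖-⊖ : ∀ u w → u ⊖ (u ⊖ w) ≡ w
⊖-⊖ (u₁ , u₂) (w₁ , w₂) = cong₂ _,_ (identity u₁ w₁) (identity u₂ w₂)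
  where
  identity : ∀ x z → x - (x - z) ≡ z
  identity = solve-∀ ℚ-ring

Congruent : Lattice → F → F → Set
Congruent K v w = (v ⊖ w) ∈L K

congruent-refl : ∀ K v → Congruent K v v
congruent-refl K v = subst (_∈L K) (sym (⊖-self v)) (∈L-0 K)

congruent-sym : ∀ K {v w} → Congruent K v w → Congruent K w v
congruent-sym K {v} {w} v≋w = subst (_∈L K) (sym (⊖-antisym v w)) (∈L-⊖ K (∈L-0 K) v≋w)

congruent-trans : ∀ K {u v w} → Congruent K u v → Congruent K v w → Congruent K u w
congruent-trans K {u} {v} {w} u≋v v≋w = subst (_∈L K) (sym (⊖-trans u v w)) (∈L-⊕ K u≋v v≋w)

⊆L-intro : ∀ K L → e₁ K ∈L L → e₂ K ∈L L → K ⊆L L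
⊆L-intro K L e₁∈L e₂∈L v (m , n , refl) = ∈L-lincomb L e₁∈L e₂∈L m n

_⊆L?_ : ∀ K L → Dec (K ⊆L L)
K ⊆L? L = map′ (λ (e₁∈L , e₂∈L) → ⊆L-intro K L e₁∈L e₂∈L) (λ K⊆L → K⊆L _ (∈L-e₁ K) , K⊆L _ (∈L-e₂ K))
               ((e₁ K ∈L? L) ×-dec (e₂ K ∈L? L))

⊆L-trans : ∀ {K L M} → K ⊆L L → L ⊆L M → K ⊆L M
⊆L-trans K⊆L L⊆M v v∈K = L⊆M v (K⊆L v v∈K)

≐L-isDecEquivalence : IsDecEquivalence _≐L_
≐L-isDecEquivalence = record
  { isEquivalence = record
    { refl  = (λ _ v∈ → v∈) , (λ _ v∈ → v∈)
    ; sym   = λ (K⊆L , L⊆K) → L⊆K , K⊆L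
    ; trans = λ {K} {L} {M} (K⊆L , L⊆K) (L⊆M , M⊆L) →
                ⊆L-trans {K} {L} {M} K⊆L L⊆M , ⊆L-trans {M} {L} {K} M⊆L L⊆K
    }
  ; _≟_ = λ K L → (K ⊆L? L) ×-dec (L ⊆L? K)
  }

≐L-decSetoid : DecSetoid 0ℓ 0ℓ
≐L-decSetoid = record { isDecEquivalence = ≐L-isDecEquivalence }

open DecSetoid ≐L-decSetoid public
  using () renaming (sym to ≐L-sym; trans to ≐L-trans)

apply-lincomb : ∀ σ a u b v → apply σ ((a · u) ⊕ (b · v)) ≡ (a · apply σ u) ⊕ (b · apply σ v)
apply-lincomb (mat p q r s) a (u₁ , u₂) b (v₁ , v₂) =
  cong₂ _,_ (identity p q a u₁ u₂ b v₁ v₂) (identity r s a u₁ u₂ b v₁ v₂)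
  where
  identity : ∀ p q a u₁ u₂ b v₁ v₂ →
    p * (a * u₁ + b * v₁) + q * (a * u₂ + b * v₂) ≡ a * (p * u₁ + q * u₂) + b * (p * v₁ + q * v₂)
  identity = solve-∀ ℚ-ring

ImageIn-intro : ∀ σ K L → apply σ (e₁ K) ∈L L → apply σ (e₂ K) ∈L L → ImageIn σ K L
ImageIn-intro σ K L σe₁∈L σe₂∈L v (m , n , refl) =
  subst (_∈L L) (sym (apply-lincomb σ (ℤ→ℚ m) (e₁ K) (ℤ→ℚ n) (e₂ K))) (∈L-lincomb L σe₁∈L σe₂∈L m n)

ImageIn? : ∀ σ K L → Dec (ImageIn σ K L)
ImageIn? σ K L = map′ (λ (σe₁∈L , σe₂∈L) → ImageIn-intro σ K L σe₁∈L σe₂∈L)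
                      (λ σK⊆L → σK⊆L _ (∈L-e₁ K) , σK⊆L _ (∈L-e₂ K))
                      ((apply σ (e₁ K) ∈L? L) ×-dec (apply σ (e₂ K) ∈L? L))

-- Finite cardinalities

module _ (S : DecSetoid 0ℓ 0ℓ) where
  open DecSetoid S using (_≈_; setoid) renaming (Carrier to A; _≟_ to _≈?_; sym to ≈-sym; trans to ≈-trans)

  hasCard-filter : ∀ {P : A → Set} → Decidable P → P Respects _≈_ → (xs : List A) →
                   (∀ a → P a → Any (a ≈_) xs) → ∃ (HasCard P _≈_)
  hasCard-filter {P} P? resp xs covers =
    length ys , ys , refl , All.all-filter P? (deduplicate _≈?_ xs) , cover ,
    Unique.filter⁺ setoid P? (deduplicate-! S xs)
    where
    ys = filter P? (deduplicate _≈?_ xs)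
    cover : ∀ a → P a → Any (a ≈_) ys
    cover a Pa = ∈-filter⁺ setoid P? resp
      (∈-deduplicate⁺ setoid _≈?_ (λ z≈y x≈y → ≈-trans x≈y (≈-sym z≈y)) (covers a Pa)) Pa

module _ {A : Set} {_≈_ : A → A → Set}
         (≈-sym : ∀ {a b} → a ≈ b → b ≈ a) (≈-trans : ∀ {a b c} → a ≈ b → b ≈ c → a ≈ c) where

  private
    ∈-─⁺ : ∀ {x y ys} (x∈ys : Any (x ≈_) ys) → Any (y ≈_) ys → ¬ x ≈ y → Any (y ≈_) (ys ─ x∈ys)
    ∈-─⁺ (here x≈z)  (here y≈z)  x≉y = ⊥-elim (x≉y (≈-trans x≈z (≈-sym y≈z)))
    ∈-─⁺ (here _)    (there y∈)  _   = y∈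
    ∈-─⁺ (there _)   (here y≈z)  _   = here y≈z
    ∈-─⁺ (there x∈)  (there y∈)  x≉y = there (∈-─⁺ x∈ y∈ x≉y)

    unique-length-≤ : ∀ {xs ys} → AllPairs.AllPairs (λ x y → ¬ x ≈ y) xs →
                      All (λ x → Any (x ≈_) ys) xs → length xs ≤ length ys
    unique-length-≤ [] [] = z≤n
    unique-length-≤ {xs = _ ∷ xs} {ys} (x≉xs ∷ uniq) (x∈ys ∷ xs⊆ys) =
      subst (suc (length xs) ≤_) (sym (length-removeAt′ ys (Any.index x∈ys)))
        (s≤s (unique-length-≤ uniq (All.zipWith (λ (x≉y , y∈ys) → ∈-─⁺ x∈ys y∈ys x≉y) (x≉xs , xs⊆ys))))

  hasCard-unique : ∀ {P : A → Set} {m n} → HasCard P _≈_ m → HasCard P _≈_ n → m ≡ n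
  hasCard-unique (xs , refl , Pxs , xs-complete , xs-unique) (ys , refl , Pys , ys-complete , ys-unique) =
    ℕ.≤-antisym (unique-length-≤ xs-unique (All.map (ys-complete _) Pxs))
                (unique-length-≤ ys-unique (All.map (xs-complete _) Pys))

hasCard-resp : ∀ {A : Set} {P P′ : A → Set} {_≈_ _≈′_ : A → A → Set} {n} →
  (∀ {a} → P a → P′ a) → (∀ {a} → P′ a → P a) →
  (∀ {a b} → a ≈ b → a ≈′ b) → (∀ {a b} → a ≈′ b → a ≈ b) →
  HasCard P _≈_ n → HasCard P′ _≈′_ n
hasCard-resp P⇒P′ P′⇒P ≈⇒≈′ ≈′⇒≈ (xs , length≡n , Pxs , complete , unique) =
  xs , length≡n , All.map P⇒P′ Pxs , (λ a P′a → Any.map ≈⇒≈′ (complete a (P′⇒P P′a))) ,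
  AllPairs.map (λ x≉y x≈′y → x≉y (≈′⇒≈ x≈′y)) unique

hasCard-map : ∀ {A B : Set} {P : A → Set} {Q : B → Set} {_≈_ : A → A → Set} {_≈′_ : B → B → Set} {n}
  (f : A → B) → (∀ {a} → P a → Q (f a)) →
  (∀ b → Q b → Σ A λ a → P a × b ≈′ f a) →
  (∀ {a a′} → P a → P a′ → f a ≈′ f a′ → a ≈ a′) →
  (∀ {a a′} → a ≈ a′ → f a ≈′ f a′) →
  (∀ {a b c} → a ≈′ b → b ≈′ c → a ≈′ c) →
  HasCard P _≈_ n → HasCard Q _≈′_ n
hasCard-map {P = P} {Q} {_≈_} {_≈′_} f P⇒Qf onto injective f-cong ≈′-trans (xs , refl , Pxs , complete , unique) =
  map f xs , length-map f xs , All.map⁺ (All.map P⇒Qf Pxs) , complete′ , AllPairs.map⁺ (injective-pairs Pxs unique)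
  where
  complete′ : ∀ b → Q b → Any (b ≈′_) (map f xs)
  complete′ b Qb = let a , Pa , b≈fa = onto b Qb in
    Any.map⁺ (Any.map (λ a≈x → ≈′-trans b≈fa (f-cong a≈x)) (complete a Pa))
  injective-pairs : ∀ {ys} → All P ys → AllPairs.AllPairs (λ x y → ¬ x ≈ y) ys →
                    AllPairs.AllPairs (λ x y → ¬ f x ≈′ f y) ys
  injective-pairs [] [] = []
  injective-pairs (Px ∷ Pys) (x≉ys ∷ uniq) =
    All.zipWith (λ (Py , x≉y) fx≈fy → x≉y (injective Px Py fx≈fy)) (Pys , x≉ys) ∷ injective-pairs Pys uniq

length-cartesianProduct : ∀ {A B : Set} (xs : List A) (ys : List B) →
                          length (cartesianProduct xs ys) ≡ length xs ℕ.* length ys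
length-cartesianProduct []       ys = refl
length-cartesianProduct (x ∷ xs) ys = trans (length-++ (map (x ,_) ys))
  (cong₂ ℕ._+_ (length-map (x ,_) ys) (length-cartesianProduct xs ys))

hasCard-grid : ∀ p r → HasCard (λ (i , j) → i < p × j < r) _≡_ (p ℕ.* r)
hasCard-grid p r =
  cartesianProduct (downFrom p) (downFrom r) ,
  trans (length-cartesianProduct (downFrom p) (downFrom r)) (cong₂ ℕ._*_ (length-downFrom p) (length-downFrom r)) ,
  All.tabulate (λ ij∈ → let i∈ , j∈ = ∈.∈-cartesianProduct⁻ (downFrom p) (downFrom r) ij∈
                        in ∈.∈-downFrom⁻ i∈ , ∈.∈-downFrom⁻ j∈) ,
  (λ _ (i<p , j<r) → ∈.∈-cartesianProduct⁺ (∈.∈-downFrom⁺ i<p) (∈.∈-downFrom⁺ j<r)) ,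
  Unique≡.cartesianProduct⁺ (Unique≡.downFrom⁺ p) (Unique≡.downFrom⁺ r)

hasCard-nonempty : ∀ {A : Set} {P : A → Set} {_≈_ : A → A → Set} {m} → HasCard P _≈_ m → ∀ a → P a →
                   ∃ λ k → m ≡ suc k
hasCard-nonempty ([] , refl , _ , complete , _) a Pa with () ← complete a Pa
hasCard-nonempty (_ ∷ xs , refl , _) _ _ = length xs , refl

-- Sublattices in Hermite normal form

point-⊖ : ∀ L a b a′ b′ → point L a b ⊖ point L a′ b′ ≡ point L (a ℤ.- a′) (b ℤ.- b′)
point-⊖ L a b a′ b′ = cong₂ _,_ (component (proj₁ (e₁ L)) (proj₁ (e₂ L))) (component (proj₂ (e₁ L)) (proj₂ (e₂ L)))
  where
  identity : ∀ a b a′ b′ x y → (a * x + b * y) - (a′ * x + b′ * y) ≡ (a - a′) * x + (b - b′) * y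
  identity = solve-∀ ℚ-ring
  component : ∀ x y → (ℤ→ℚ a * x + ℤ→ℚ b * y) - (ℤ→ℚ a′ * x + ℤ→ℚ b′ * y)
                      ≡ ℤ→ℚ (a ℤ.- a′) * x + ℤ→ℚ (b ℤ.- b′) * y
  component x y = trans (identity (ℤ→ℚ a) (ℤ→ℚ b) (ℤ→ℚ a′) (ℤ→ℚ b′) x y)
    (sym (cong₂ (λ c e → c * x + e * y) (ℤ→ℚ-minus a a′) (ℤ→ℚ-minus b b′)))

basisDet-point : ∀ L a₁ b₁ a₂ b₂ →
  basisDet (point L a₁ b₁) (point L a₂ b₂) ≡ ℤ→ℚ (a₁ ℤ.* b₂ ℤ.- a₂ ℤ.* b₁) * latticeDet L
basisDet-point L a₁ b₁ a₂ b₂ = begin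
  basisDet (point L a₁ b₁) (point L a₂ b₂)
    ≡⟨ identity (ℤ→ℚ a₁) (ℤ→ℚ b₁) (ℤ→ℚ a₂) (ℤ→ℚ b₂) (proj₁ (e₁ L)) (proj₂ (e₁ L)) (proj₁ (e₂ L)) (proj₂ (e₂ L)) ⟩
  (ℤ→ℚ a₁ * ℤ→ℚ b₂ - ℤ→ℚ a₂ * ℤ→ℚ b₁) * latticeDet L
    ≡⟨ cong (_* latticeDet L) (sym (trans (ℤ→ℚ-minus (a₁ ℤ.* b₂) (a₂ ℤ.* b₁)) (cong₂ _-_ (ℤ→ℚ-* a₁ b₂) (ℤ→ℚ-* a₂ b₁)))) ⟩
  ℤ→ℚ (a₁ ℤ.* b₂ ℤ.- a₂ ℤ.* b₁) * latticeDet L ∎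
  where
  open ≡-Reasoning
  identity : ∀ a₁ b₁ a₂ b₂ x₁ y₁ x₂ y₂ →
    (a₁ * x₁ + b₁ * x₂) * (a₂ * y₁ + b₂ * y₂) - (a₂ * x₁ + b₂ * x₂) * (a₁ * y₁ + b₁ * y₂)
      ≡ (a₁ * b₂ - a₂ * b₁) * (x₁ * y₂ - x₂ * y₁)
  identity = solve-∀ ℚ-ring

∈L-point-lincomb : ∀ L K {a b a′ b′} → point L a b ∈L K → point L a′ b′ ∈L K →
  ∀ s t → point L (s ℤ.* a ℤ.+ t ℤ.* a′) (s ℤ.* b ℤ.+ t ℤ.* b′) ∈L K
∈L-point-lincomb L K {a} {b} {a′} {b′} ab∈K a′b′∈K s t =
  subst (_∈L K) (point-lincomb L s a b t a′ b′) (∈L-lincomb K ab∈K a′b′∈K s t)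

-- The diagonal entries are 1+p and 1+r, so that every triple p, q, r gives a lattice.
hnf : Lattice → ℕ → ℕ → ℕ → Lattice
hnf L p q r = lattice (point L (+ suc p) (+ 0)) (point L (+ q) (+ suc r)) independent
  where
  independent : ¬ basisDet (point L (+ suc p) (+ 0)) (point L (+ q) (+ suc r)) ≡ 0ℚ
  independent det≡0 = *-≢0 (ℤ→ℚ-suc≢0 (r ℕ.+ p ℕ.* suc r)) (indep L)
    (trans (cong (λ z → ℤ→ℚ z * latticeDet L) (sym det-integer))
           (trans (sym (basisDet-point L (+ suc p) (+ 0) (+ q) (+ suc r))) det≡0))
    where
    det-integer : + suc p ℤ.* + suc r ℤ.- + q ℤ.* + 0 ≡ + suc (r ℕ.+ p ℕ.* suc r)
    det-integer = trans (cong (λ z → + suc p ℤ.* + suc r ℤ.- z) (ℤ.*-zeroʳ (+ q))) (ℤ.+-identityʳ _)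

∈hnf : ∀ L p q r s t → point L (s ℤ.* + suc p ℤ.+ t ℤ.* + q) (t ℤ.* + suc r) ∈L hnf L p q r
∈hnf L p q r s t = s , t , sym (trans (point-lincomb L s (+ suc p) (+ 0) t (+ q) (+ suc r))
  (cong (point L (s ℤ.* + suc p ℤ.+ t ℤ.* + q)) (trans (cong (ℤ._+ t ℤ.* + suc r) (ℤ.*-zeroʳ s)) (ℤ.+-identityˡ (t ℤ.* + suc r)))))

∈hnf⁻ : ∀ L p q r {v} → v ∈L hnf L p q r →
  ∃₂ λ s t → v ≡ point L (s ℤ.* + suc p ℤ.+ t ℤ.* + q) (t ℤ.* + suc r)
∈hnf⁻ L p q r (s , t , v≡) = s , t , trans v≡ (sym (proj₂ (proj₂ (∈hnf L p q r s t))))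

-- Division with remainder by 1+r in the second coordinate, then by 1+p in the first.
hnf-reduce : ∀ L p q r m n → ∃₂ λ i j → (i < suc p × j < suc r) ×
  Congruent (hnf L p q r) (point L m n) (point L (+ i) (+ j))
hnf-reduce L p q r m n =
  i , j , (n%ℕd<d a (suc p) , n%ℕd<d n (suc r)) ,
  subst (_∈L hnf L p q r) (sym (trans (point-⊖ L m n (+ i) (+ j)) (cong₂ (point L) m-i≡ n-j≡))) (∈hnf L p q r s t)
  where
  t = n /ℕ suc r
  j = n %ℕ suc r
  a = m ℤ.- t ℤ.* + q
  s = a /ℕ suc p
  i = a %ℕ suc p
  m-i≡ : m ℤ.- + i ≡ s ℤ.* + suc p ℤ.+ t ℤ.* + q
  m-i≡ = begin
    m ℤ.- + i                          ≡⟨ identity m t (+ q) (+ i) ⟩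
    (a ℤ.- + i) ℤ.+ t ℤ.* + q          ≡⟨ cong (ℤ._+ t ℤ.* + q) (a≡b+c⇒a-b≡c a (+ i) (s ℤ.* + suc p) (a≡a%ℕn+[a/ℕn]*n a (suc p))) ⟩
    s ℤ.* + suc p ℤ.+ t ℤ.* + q        ∎
    where
    open ≡-Reasoning
    identity : ∀ m t q i → m ℤ.- i ≡ ((m ℤ.- t ℤ.* q) ℤ.- i) ℤ.+ t ℤ.* q
    identity = ℤ-Solver.solve-∀
  n-j≡ : n ℤ.- + j ≡ t ℤ.* + suc r
  n-j≡ = a≡b+c⇒a-b≡c n (+ j) (t ℤ.* + suc r) (a≡a%ℕn+[a/ℕn]*n n (suc r))

hnf-reduced-unique : ∀ L p q r {i j i′ j′} → i < suc p → j < suc r → i′ < suc p → j′ < suc r →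
  Congruent (hnf L p q r) (point L (+ i) (+ j)) (point L (+ i′) (+ j′)) → (i , j) ≡ (i′ , j′)
hnf-reduced-unique L p q r {i} {j} {i′} {j′} i<p j<r i′<p j′<r congruent =
  cong₂ _,_ (≡-from-difference i-i′≡0) (≡-from-difference j-j′≡0)
  where
  s = proj₁ (∈hnf⁻ L p q r congruent)
  t = proj₁ (proj₂ (∈hnf⁻ L p q r congruent))
  coordinates = point-injective L {+ i ℤ.- + i′} {+ j ℤ.- + j′}
    {s ℤ.* + suc p ℤ.+ t ℤ.* + q} {t ℤ.* + suc r}
    (trans (sym (point-⊖ L (+ i) (+ j) (+ i′) (+ j′))) (proj₂ (proj₂ (∈hnf⁻ L p q r congruent))))
  t≡0 : t ≡ + 0
  t≡0 = x-y≡t*r⇒t≡0 t j<r j′<r (proj₂ coordinates)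
  i-i′≡s·p : + i ℤ.- + i′ ≡ s ℤ.* + suc p
  i-i′≡s·p = trans (proj₁ coordinates)
    (trans (cong (λ t → s ℤ.* + suc p ℤ.+ t ℤ.* + q) t≡0) (ℤ.+-identityʳ (s ℤ.* + suc p)))
  i-i′≡0 : + i ℤ.- + i′ ≡ + 0
  i-i′≡0 = trans i-i′≡s·p (cong (ℤ._* + suc p) (x-y≡t*r⇒t≡0 s i<p i′<p i-i′≡s·p))
  j-j′≡0 : + j ℤ.- + j′ ≡ + 0
  j-j′≡0 = trans (proj₂ coordinates) (cong (ℤ._* + suc r) t≡0)
  ≡-from-difference : ∀ {x y} → + x ℤ.- + y ≡ + 0 → x ≡ y
  ≡-from-difference {x} {y} e = ℤ.+-injective (ℤ.i-j≡0⇒i≡j (+ x) (+ y) e)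

hnf-index : ∀ L p q r → HasIndex L (hnf L p q r) (suc p ℕ.* suc r)
hnf-index L p q r =
  hasCard-map {P = λ (i , j) → i < suc p × j < suc r} {Q = _∈L L} {_≈_ = _≡_} {_≈′_ = Congruent (hnf L p q r)}
    (λ (i , j) → point L (+ i) (+ j))
    (λ {(i , j)} _ → + i , + j , refl)
    reduce
    (λ (i<p , j<r) (i′<p , j′<r) → hnf-reduced-unique L p q r i<p j<r i′<p j′<r)
    (λ { {i , j} refl → congruent-refl (hnf L p q r) (point L (+ i) (+ j)) })
    (λ {u} {v} {w} → congruent-trans (hnf L p q r) {u} {v} {w})
    (hasCard-grid (suc p) (suc r))
  where
  reduce : ∀ v → v ∈L L → Σ (ℕ × ℕ) λ (i , j) → (i < suc p × j < suc r) × Congruent (hnf L p q r) v (point L (+ i) (+ j))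
  reduce v (m , n , refl) = let i , j , bounds , congruent = hnf-reduce L p q r m n in (i , j) , bounds , congruent

∈L-point-neg : ∀ L K {a b} → point L a b ∈L K → point L (ℤ.- a) (ℤ.- b) ∈L K
∈L-point-neg L K {a} {b} ab∈K =
  subst (λ (x , y) → point L x y ∈L K) (cong₂ _,_ (negation a) (negation b))
    (∈L-point-lincomb L K {a} {b} {a} {b} ab∈K ab∈K (ℤ.- + 1) (+ 0))
  where
  negation : ∀ x → ℤ.- + 1 ℤ.* x ℤ.+ + 0 ℤ.* x ≡ ℤ.- x
  negation = ℤ-Solver.solve-∀

module HermiteNormalForm (L K : Lattice) (K⊆L : K ⊆L L) where

  private
    a₁ b₁ a₂ b₂ : ℤ
    a₁ = proj₁ (K⊆L _ (∈L-e₁ K))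
    b₁ = proj₁ (proj₂ (K⊆L _ (∈L-e₁ K)))
    a₂ = proj₁ (K⊆L _ (∈L-e₂ K))
    b₂ = proj₁ (proj₂ (K⊆L _ (∈L-e₂ K)))

    first∈K : point L a₁ b₁ ∈L K
    first∈K = subst (_∈L K) (proj₂ (proj₂ (K⊆L _ (∈L-e₁ K)))) (∈L-e₁ K)

    second∈K : point L a₂ b₂ ∈L K
    second∈K = subst (_∈L K) (proj₂ (proj₂ (K⊆L _ (∈L-e₂ K)))) (∈L-e₂ K)

    D : ℤ
    D = a₁ ℤ.* b₂ ℤ.- a₂ ℤ.* b₁

    D≢0 : ¬ D ≡ + 0
    D≢0 D≡0 = indep K (begin
      latticeDet K                                   ≡⟨ cong₂ basisDet (proj₂ (proj₂ (K⊆L _ (∈L-e₁ K))))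
                                                                       (proj₂ (proj₂ (K⊆L _ (∈L-e₂ K)))) ⟩
      basisDet (point L a₁ b₁) (point L a₂ b₂)       ≡⟨ basisDet-point L a₁ b₁ a₂ b₂ ⟩
      ℤ→ℚ D * latticeDet L                           ≡⟨ cong (λ z → ℤ→ℚ z * latticeDet L) D≡0 ⟩
      0ℚ * latticeDet L                              ≡⟨ ℚ.*-zeroˡ (latticeDet L) ⟩
      0ℚ                                             ∎)
      where open ≡-Reasoning

    D0∈K : point L D (+ 0) ∈L K
    D0∈K = subst (λ (x , y) → point L x y ∈L K) (cong₂ _,_ (first a₁ b₁ a₂ b₂) (second b₁ b₂))
      (∈L-point-lincomb L K {a₁} {b₁} {a₂} {b₂} first∈K second∈K b₂ (ℤ.- b₁))
      where
      first : ∀ a₁ b₁ a₂ b₂ → b₂ ℤ.* a₁ ℤ.+ ℤ.- b₁ ℤ.* a₂ ≡ a₁ ℤ.* b₂ ℤ.- a₂ ℤ.* b₁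
      first = ℤ-Solver.solve-∀
      second : ∀ b₁ b₂ → b₂ ℤ.* b₁ ℤ.+ ℤ.- b₁ ℤ.* b₂ ≡ + 0
      second = ℤ-Solver.solve-∀

    0D∈K : point L (+ 0) D ∈L K
    0D∈K = subst (λ (x , y) → point L x y ∈L K) (cong₂ _,_ (first a₁ a₂) (second a₁ b₁ a₂ b₂))
      (∈L-point-lincomb L K {a₁} {b₁} {a₂} {b₂} first∈K second∈K (ℤ.- a₂) a₁)
      where
      first : ∀ a₁ a₂ → ℤ.- a₂ ℤ.* a₁ ℤ.+ a₁ ℤ.* a₂ ≡ + 0
      first = ℤ-Solver.solve-∀
      second : ∀ a₁ b₁ a₂ b₂ → ℤ.- a₂ ℤ.* b₁ ℤ.+ a₁ ℤ.* b₂ ≡ a₁ ℤ.* b₂ ℤ.- a₂ ℤ.* b₁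
      second = ℤ-Solver.solve-∀

  -- Abstract, like the other searches below, so that type checking never unfolds it.
  abstract
    diagonal∈K : ∃ λ M → point L (+ suc M) (+ 0) ∈L K × point L (+ 0) (+ suc M) ∈L K
    diagonal∈K = positive D D≢0 D0∈K 0D∈K
      where
      positive : ∀ d → ¬ d ≡ + 0 → point L d (+ 0) ∈L K → point L (+ 0) d ∈L K →
                 ∃ λ M → point L (+ suc M) (+ 0) ∈L K × point L (+ 0) (+ suc M) ∈L K
      positive (+ zero)    d≢0 _    _    = ⊥-elim (d≢0 refl)
      positive (+ suc M)   _   d0∈K 0d∈K = M , d0∈K , 0d∈K
      positive (-[1+ M ])  _   d0∈K 0d∈K =
        M , ∈L-point-neg L K { -[1+ M ]} {+ 0} d0∈K , ∈L-point-neg L K {+ 0} { -[1+ M ]} 0d∈K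

  private
    ⊖-point-0 : ∀ v → v ⊖ point L (+ 0) (+ 0) ≡ v
    ⊖-point-0 (x , y) = cong₂ _,_ (identity x (proj₁ (e₁ L)) (proj₁ (e₂ L))) (identity y (proj₂ (e₁ L)) (proj₂ (e₂ L)))
      where
      identity : ∀ x a b → x - (0ℚ * a + 0ℚ * b) ≡ x
      identity = solve-∀ ℚ-ring

    module _ {p q r : ℕ} (p-least : ∀ {k} → k < p → ¬ point L (+ suc k) (+ 0) ∈L K)
             (r-least : ∀ {k} → k < r → ¬ (∃ λ q → q < suc p × point L (+ q) (+ suc k) ∈L K))
             (hnf⊆K : hnf L p q r ⊆L K) where

      reduced-zero : ∀ {i j} → i < suc p → j < suc r → point L (+ i) (+ j) ∈L K → (i , j) ≡ (0 , 0)
      reduced-zero {i}     {suc j} i<p       (s≤s j<r) ij∈K = ⊥-elim (r-least j<r (i , i<p , ij∈K))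
      reduced-zero {suc i} {zero}  (s≤s i<p) _         i0∈K = ⊥-elim (p-least i<p i0∈K)
      reduced-zero {zero}  {zero}  _         _         _    = refl

      point∈hnf : ∀ m n → point L m n ∈L K → point L m n ∈L hnf L p q r
      point∈hnf m n mn∈K = subst (_∈L hnf L p q r) (⊖-point-0 (point L m n)) mn-0∈hnf
        where
        reduction = hnf-reduce L p q r m n
        i = proj₁ reduction
        j = proj₁ (proj₂ reduction)
        congruent : Congruent (hnf L p q r) (point L m n) (point L (+ i) (+ j))
        congruent = proj₂ (proj₂ (proj₂ reduction))
        ij∈K : point L (+ i) (+ j) ∈L K
        ij∈K = subst (_∈L K) (⊖-⊖ (point L m n) (point L (+ i) (+ j))) (∈L-⊖ K mn∈K (hnf⊆K _ congruent))
        ij≡0 : (i , j) ≡ (0 , 0)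
        ij≡0 = reduced-zero (proj₁ (proj₁ (proj₂ (proj₂ reduction)))) (proj₂ (proj₁ (proj₂ (proj₂ reduction)))) ij∈K
        mn-0∈hnf : Congruent (hnf L p q r) (point L m n) (point L (+ 0) (+ 0))
        mn-0∈hnf = subst (λ (i , j) → Congruent (hnf L p q r) (point L m n) (point L (+ i) (+ j))) ij≡0 congruent

      K⊆hnf : K ⊆L hnf L p q r
      K⊆hnf v v∈K =
        let m , n , v≡mn = K⊆L v v∈K
        in subst (_∈L hnf L p q r) (sym v≡mn) (point∈hnf m n (subst (_∈L K) v≡mn v∈K))

  -- 1+p is the least positive n with n e₁ ∈ K, and 1+r the least positive second coordinate of a
  -- point q e₁ + (1+r) e₂ ∈ K with q ≤ p; reducing modulo this basis then leaves no remainder.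
  private
    hnf-witness : ∃ λ p → ∃ λ q → ∃ λ r → q < suc p × K ≐L hnf L p q r
    hnf-witness = p , q , r , q<p , K⊆hnf {p} {q} {r} p-least r-least hnf⊆K , hnf⊆K
      where
      M = proj₁ diagonal∈K
      FirstRow SecondRow : ℕ → Set
      FirstRow k = point L (+ suc k) (+ 0) ∈L K
      first-row : ∃ λ p → FirstRow p × (∀ {k} → k < p → ¬ FirstRow k)
      first-row = least-witness (λ k → point L (+ suc k) (+ 0) ∈L? K) {M} (proj₁ (proj₂ diagonal∈K))
      p = proj₁ first-row
      p-least = proj₂ (proj₂ first-row)
      SecondRow k = ∃ λ q → q < suc p × point L (+ q) (+ suc k) ∈L K
      second-row : ∃ λ r → SecondRow r × (∀ {k} → k < r → ¬ SecondRow k)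
      second-row = least-witness (λ k → ℕ.anyUpTo? (λ q → point L (+ q) (+ suc k) ∈L? K) (suc p)) {M}
                     (0 , s≤s z≤n , proj₂ (proj₂ diagonal∈K))
      r = proj₁ second-row
      r-least = proj₂ (proj₂ second-row)
      q = proj₁ (proj₁ (proj₂ second-row))
      q<p = proj₁ (proj₂ (proj₁ (proj₂ second-row)))
      hnf⊆K : hnf L p q r ⊆L K
      hnf⊆K = ⊆L-intro (hnf L p q r) K (proj₁ (proj₂ first-row)) (proj₂ (proj₂ (proj₁ (proj₂ second-row))))

  abstract
    hermite-normal-form : ∃ λ p → ∃ λ q → ∃ λ r → q < suc p × K ≐L hnf L p q r
    hermite-normal-form = hnf-witness

-- Matrices and the orthogonal group of N_{F/ℚ}

mat-≡ : ∀ {p q r s p′ q′ r′ s′} → p ≡ p′ → q ≡ q′ → r ≡ r′ → s ≡ s′ → mat p q r s ≡ mat p′ q′ r′ s′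
mat-≡ refl refl refl refl = refl

mat-≟ : ∀ (A B : Mat) → Dec (A ≡ B)
mat-≟ (mat p q r s) (mat p′ q′ r′ s′) =
  map′ (λ (p≡ , q≡ , r≡ , s≡) → mat-≡ p≡ q≡ r≡ s≡)
       (λ A≡B → cong Mat.m11 A≡B , cong Mat.m12 A≡B , cong Mat.m21 A≡B , cong Mat.m22 A≡B)
       ((p ≟ p′) ×-dec (q ≟ q′) ×-dec (r ≟ r′) ×-dec (s ≟ s′))

mat-ext : ∀ A B → (∀ v → apply A v ≡ apply B v) → A ≡ B
mat-ext (mat p q r s) (mat p′ q′ r′ s′) A≗B = mat-≡
  (trans (first p q) (trans (cong proj₁ (A≗B (1ℚ , 0ℚ))) (sym (first p′ q′))))
  (trans (second p q) (trans (cong proj₁ (A≗B (0ℚ , 1ℚ))) (sym (second p′ q′))))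
  (trans (first r s) (trans (cong proj₂ (A≗B (1ℚ , 0ℚ))) (sym (first r′ s′))))
  (trans (second r s) (trans (cong proj₂ (A≗B (0ℚ , 1ℚ))) (sym (second r′ s′))))
  where
  first : ∀ x y → x ≡ x * 1ℚ + y * 0ℚ
  first = solve-∀ ℚ-ring
  second : ∀ x y → y ≡ x * 0ℚ + y * 1ℚ
  second = solve-∀ ℚ-ring

apply-compose : ∀ A B v → apply (compose A B) v ≡ apply A (apply B v)
apply-compose (mat p q r s) (mat p′ q′ r′ s′) (x , y) =
  cong₂ _,_ (identity p q p′ q′ r′ s′ x y) (identity r s p′ q′ r′ s′ x y)
  where
  identity : ∀ p q p′ q′ r′ s′ x y →
    (p * p′ + q * r′) * x + (p * q′ + q * s′) * y ≡ p * (p′ * x + q′ * y) + q * (r′ * x + s′ * y)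
  identity = solve-∀ ℚ-ring

apply-idMat : ∀ v → apply idMat v ≡ v
apply-idMat (x , y) = cong₂ _,_ (first x y) (second x y)
  where
  first : ∀ x y → 1ℚ * x + 0ℚ * y ≡ x
  first = solve-∀ ℚ-ring
  second : ∀ x y → 0ℚ * x + 1ℚ * y ≡ y
  second = solve-∀ ℚ-ring

det-compose : ∀ A B → det (compose A B) ≡ det A * det B
det-compose (mat p q r s) (mat p′ q′ r′ s′) = identity p q r s p′ q′ r′ s′
  where
  identity : ∀ p q r s p′ q′ r′ s′ →
    (p * p′ + q * r′) * (r * q′ + s * s′) - (p * q′ + q * s′) * (r * p′ + s * r′)
      ≡ (p * s - q * r) * (p′ * s′ - q′ * r′)
  identity = solve-∀ ℚ-ring

ImageIn-compose : ∀ A B K M L → ImageIn B K M → ImageIn A M L → ImageIn (compose A B) K L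
ImageIn-compose A B K M L BK⊆M AM⊆L v v∈K =
  subst (_∈L L) (sym (apply-compose A B v)) (AM⊆L (apply B v) (BK⊆M v v∈K))

ImageIn-power : ∀ ρ K → ImageIn ρ K K → ∀ k → ImageIn (power ρ k) K K
ImageIn-power ρ K ρK⊆K zero    v v∈K = subst (_∈L K) (sym (apply-idMat v)) v∈K
ImageIn-power ρ K ρK⊆K (suc k) =
  ImageIn-compose ρ (power ρ k) K K K (ImageIn-power ρ K ρK⊆K k) ρK⊆K

-- ρ⁻¹ = ρᵏ when ρᵏ⁺¹ = 1, so ρ(K) ⊆ K already forces ρ(K) = K.
Stable-intro : ∀ ρ → FiniteOrder ρ → ∀ K → ImageIn ρ K K → Stable ρ K
Stable-intro ρ (k , ρᵏ⁺¹≡1) K ρK⊆K = ρK⊆K , λ v v∈K →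
  apply (power ρ k) v , ImageIn-power ρ K ρK⊆K k v v∈K ,
  trans (sym (apply-compose ρ (power ρ k) v)) (trans (cong (λ M → apply M v) ρᵏ⁺¹≡1) (apply-idMat v))

Stable? : ∀ ρ → FiniteOrder ρ → ∀ K → Dec (Stable ρ K)
Stable? ρ ρ-finite K = map′ (Stable-intro ρ ρ-finite K) proj₁ (ImageIn? ρ K K)

Stable-resp : ∀ ρ {K K′} → K ≐L K′ → Stable ρ K → Stable ρ K′
Stable-resp ρ (K⊆K′ , K′⊆K) (ρK⊆K , K⊆ρK) =
  (λ v v∈K′ → K⊆K′ _ (ρK⊆K v (K′⊆K v v∈K′))) ,
  (λ v v∈K′ → let w , w∈K , ρw≡v = K⊆ρK v (K′⊆K v v∈K′) in w , K⊆K′ w w∈K , ρw≡v)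

multMat : ℕ → F → Mat
multMat d (a , b) = mat a (- (ℕ→ℚ d * b)) b a

apply-multMat : ∀ d u v → apply (multMat d u) v ≡ mulF d u v
apply-multMat d (a , b) (x , y) = cong₂ _,_ (first a b x y (ℕ→ℚ d)) (second a b x y)
  where
  first : ∀ a b x y D → a * x + - (D * b) * y ≡ a * x - D * (b * y)
  first = solve-∀ ℚ-ring
  second : ∀ a b x y → b * x + a * y ≡ a * y + b * x
  second = solve-∀ ℚ-ring

normF-mulF : ∀ d u v → normF d (mulF d u v) ≡ normF d u * normF d v
normF-mulF d (a , b) (x , y) = identity a b x y (ℕ→ℚ d)
  where
  identity : ∀ a b x y D →
    (a * x - D * (b * y)) * (a * x - D * (b * y)) + D * ((a * y + b * x) * (a * y + b * x))
      ≡ (a * a + D * (b * b)) * (x * x + D * (y * y))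
  identity = solve-∀ ℚ-ring

multMat-InO⁺ : ∀ d u → normF d u ≡ 1ℚ → InO⁺ d (multMat d u)
multMat-InO⁺ d u@(a , b) Nu≡1 =
  (λ v → begin
    normF d (apply (multMat d u) v)   ≡⟨ cong (normF d) (apply-multMat d u v) ⟩
    normF d (mulF d u v)              ≡⟨ normF-mulF d u v ⟩
    normF d u * normF d v             ≡⟨ cong (_* normF d v) Nu≡1 ⟩
    1ℚ * normF d v                    ≡⟨ ℚ.*-identityˡ (normF d v) ⟩
    normF d v                         ∎) ,
  trans (identity a b (ℕ→ℚ d)) Nu≡1
  where
  open ≡-Reasoning
  identity : ∀ a b D → a * a - - (D * b) * b ≡ a * a + D * (b * b)
  identity = solve-∀ ℚ-ring

idMat-InO⁺ : ∀ d → InO⁺ d idMat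
idMat-InO⁺ d = (λ v → cong (normF d) (apply-idMat v)) , refl

module Orthogonal (d : ℕ) (σ : Mat) (σ∈O : InO d σ) where

  private
    D = ℕ→ℚ d
    p = Mat.m11 σ
    q = Mat.m12 σ
    r = Mat.m21 σ
    s = Mat.m22 σ

  column₁-norm : p * p + D * (r * r) ≡ 1ℚ
  column₁-norm = trans (identity p q r s D) (trans (σ∈O (1ℚ , 0ℚ)) (value D))
    where
    identity : ∀ p q r s D → p * p + D * (r * r)
      ≡ (p * 1ℚ + q * 0ℚ) * (p * 1ℚ + q * 0ℚ) + D * ((r * 1ℚ + s * 0ℚ) * (r * 1ℚ + s * 0ℚ))
    identity = solve-∀ ℚ-ring
    value : ∀ D → 1ℚ * 1ℚ + D * (0ℚ * 0ℚ) ≡ 1ℚ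
    value = solve-∀ ℚ-ring

  column₂-norm : q * q + D * (s * s) ≡ D
  column₂-norm = trans (identity p q r s D) (trans (σ∈O (0ℚ , 1ℚ)) (value D))
    where
    identity : ∀ p q r s D → q * q + D * (s * s)
      ≡ (p * 0ℚ + q * 1ℚ) * (p * 0ℚ + q * 1ℚ) + D * ((r * 0ℚ + s * 1ℚ) * (r * 0ℚ + s * 1ℚ))
    identity = solve-∀ ℚ-ring
    value : ∀ D → 0ℚ * 0ℚ + D * (1ℚ * 1ℚ) ≡ D
    value = solve-∀ ℚ-ring

  -- Polarisation: compare N(σ(1,1)) = N(1,1) with the two column norms.
  columns-orthogonal : p * q + D * (r * s) ≡ 0ℚ
  columns-orthogonal with p * q + D * (r * s) ≟ 0ℚ
  ... | yes X≡0 = X≡0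
  ... | no  X≢0 = ⊥-elim (*-≢0 {1ℚ + 1ℚ} (λ ()) X≢0 (begin
    (1ℚ + 1ℚ) * (p * q + D * (r * s))
      ≡⟨ identity p q r s D ⟩
    ((p * 1ℚ + q * 1ℚ) * (p * 1ℚ + q * 1ℚ) + D * ((r * 1ℚ + s * 1ℚ) * (r * 1ℚ + s * 1ℚ)))
      - (p * p + D * (r * r)) - (q * q + D * (s * s))
      ≡⟨ cong₂ (λ a b → a - (p * p + D * (r * r)) - b) (σ∈O (1ℚ , 1ℚ)) column₂-norm ⟩
    (1ℚ * 1ℚ + D * (1ℚ * 1ℚ)) - (p * p + D * (r * r)) - D
      ≡⟨ cong (λ a → (1ℚ * 1ℚ + D * (1ℚ * 1ℚ)) - a - D) column₁-norm ⟩
    (1ℚ * 1ℚ + D * (1ℚ * 1ℚ)) - 1ℚ - D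
      ≡⟨ value D ⟩
    0ℚ ∎))
    where
    open ≡-Reasoning
    identity : ∀ p q r s D → (1ℚ + 1ℚ) * (p * q + D * (r * s))
      ≡ ((p * 1ℚ + q * 1ℚ) * (p * 1ℚ + q * 1ℚ) + D * ((r * 1ℚ + s * 1ℚ) * (r * 1ℚ + s * 1ℚ)))
        - (p * p + D * (r * r)) - (q * q + D * (s * s))
    identity = solve-∀ ℚ-ring
    value : ∀ D → (1ℚ * 1ℚ + D * (1ℚ * 1ℚ)) - 1ℚ - D ≡ 0ℚ
    value = solve-∀ ℚ-ring

  -- Lagrange's identity D det(σ)² = N(col₁) N(col₂) - ⟨col₁, col₂⟩².
  det≡±1 : ¬ D ≡ 0ℚ → det σ ≡ 1ℚ ⊎ det σ ≡ - 1ℚ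
  det≡±1 D≢0 = x*x≡1⇒x≡±1 (det σ) (*-cancelˡ D≢0 (begin
    D * (det σ * det σ)                                                 ≡⟨ lagrange p q r s D ⟩
    (p * p + D * (r * r)) * (q * q + D * (s * s)) - X * X               ≡⟨ cong₂ (λ z y → z * y - X * X) column₁-norm column₂-norm ⟩
    1ℚ * D - X * X                                                      ≡⟨ cong (λ x → 1ℚ * D - x * x) columns-orthogonal ⟩
    1ℚ * D - 0ℚ * 0ℚ                                                    ≡⟨ value D ⟩
    D * 1ℚ                                                              ∎))
    where
    open ≡-Reasoning
    X = p * q + D * (r * s)
    lagrange : ∀ p q r s D → D * ((p * s - q * r) * (p * s - q * r))
      ≡ (p * p + D * (r * r)) * (q * q + D * (s * s)) - (p * q + D * (r * s)) * (p * q + D * (r * s))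
    lagrange = solve-∀ ℚ-ring
    value : ∀ D → 1ℚ * D - 0ℚ * 0ℚ ≡ D * 1ℚ
    value = solve-∀ ℚ-ring

  module Proper (det≡1 : det σ ≡ 1ℚ) where

    m22≡m11 : s ≡ p
    m22≡m11 = begin
      s                                  ≡⟨ sym (ℚ.*-identityʳ s) ⟩
      s * 1ℚ                             ≡⟨ cong (s *_) (sym column₁-norm) ⟩
      s * (p * p + D * (r * r))          ≡⟨ identity p q r s D ⟩
      p * det σ + r * (p * q + D * (r * s)) ≡⟨ cong₂ (λ x y → p * x + r * y) det≡1 columns-orthogonal ⟩
      p * 1ℚ + r * 0ℚ                    ≡⟨ value p r ⟩
      p                                  ∎
      where
      open ≡-Reasoning
      identity : ∀ p q r s D → s * (p * p + D * (r * r)) ≡ p * (p * s - q * r) + r * (p * q + D * (r * s))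
      identity = solve-∀ ℚ-ring
      value : ∀ p r → p * 1ℚ + r * 0ℚ ≡ p
      value = solve-∀ ℚ-ring

    m12≡-Dm21 : q ≡ - (D * r)
    m12≡-Dm21 = begin
      q                                  ≡⟨ sym (ℚ.*-identityʳ q) ⟩
      q * 1ℚ                             ≡⟨ cong (q *_) (sym column₁-norm) ⟩
      q * (p * p + D * (r * r))          ≡⟨ identity p q r s D ⟩
      - (D * r) * det σ + p * (p * q + D * (r * s)) ≡⟨ cong₂ (λ x y → - (D * r) * x + p * y) det≡1 columns-orthogonal ⟩
      - (D * r) * 1ℚ + p * 0ℚ            ≡⟨ value (D * r) p ⟩
      - (D * r)                          ∎
      where
      open ≡-Reasoning
      identity : ∀ p q r s D → q * (p * p + D * (r * r)) ≡ - (D * r) * (p * s - q * r) + p * (p * q + D * (r * s))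
      identity = solve-∀ ℚ-ring
      value : ∀ x p → - x * 1ℚ + p * 0ℚ ≡ - x
      value = solve-∀ ℚ-ring

    ≡multMat : σ ≡ multMat d (p , r)
    ≡multMat = mat-≡ refl m12≡-Dm21 refl m22≡m11

InO⁺-intro : ∀ d p q r s → q ≡ - (ℕ→ℚ d * r) → s ≡ p → normF d (p , r) ≡ 1ℚ → InO⁺ d (mat p q r s)
InO⁺-intro d p _ r _ refl refl N≡1 = multMat-InO⁺ d (p , r) N≡1

InO⁺? : ∀ d σ → Dec (InO⁺ d σ)
InO⁺? d (mat p q r s) = map′ intro elim ((q ≟ - (ℕ→ℚ d * r)) ×-dec (s ≟ p) ×-dec (normF d (p , r) ≟ 1ℚ))
  where
  intro : q ≡ - (ℕ→ℚ d * r) × s ≡ p × normF d (p , r) ≡ 1ℚ → InO⁺ d (mat p q r s)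
  intro (q≡ , s≡ , N≡1) = InO⁺-intro d p q r s q≡ s≡ N≡1
  elim : InO⁺ d (mat p q r s) → q ≡ - (ℕ→ℚ d * r) × s ≡ p × normF d (p , r) ≡ 1ℚ
  elim (σ∈O , det≡1) = Proper.m12≡-Dm21 det≡1 , Proper.m22≡m11 det≡1 , column₁-norm
    where open Orthogonal d (mat p q r s) σ∈O

conjMat : Mat
conjMat = mat 1ℚ 0ℚ 0ℚ (- 1ℚ)

conjMat-InO : ∀ d → InO d conjMat
conjMat-InO d (a , b) = identity a b (ℕ→ℚ d)
  where
  identity : ∀ a b D → (1ℚ * a + 0ℚ * b) * (1ℚ * a + 0ℚ * b) + D * ((0ℚ * a + - 1ℚ * b) * (0ℚ * a + - 1ℚ * b))
                       ≡ a * a + D * (b * b)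
  identity = solve-∀ ℚ-ring

InO-compose : ∀ d A B → InO d A → InO d B → InO d (compose A B)
InO-compose d A B A∈O B∈O v = trans (cong (normF d) (apply-compose A B v)) (trans (A∈O (apply B v)) (B∈O v))

conjMat-involutive : ∀ σ → compose conjMat (compose conjMat σ) ≡ σ
conjMat-involutive (mat p q r s) = mat-≡ (first p r) (first q s) (second p r) (second q s)
  where
  first : ∀ x y → 1ℚ * (1ℚ * x + 0ℚ * y) + 0ℚ * (0ℚ * x + - 1ℚ * y) ≡ x
  first = solve-∀ ℚ-ring
  second : ∀ x y → 0ℚ * (1ℚ * x + 0ℚ * y) + - 1ℚ * (0ℚ * x + - 1ℚ * y) ≡ y
  second = solve-∀ ℚ-ring

det-conjMat∘ : ∀ σ → det (compose conjMat σ) ≡ - 1ℚ * det σ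
det-conjMat∘ σ = det-compose conjMat σ

module _ (d : ℕ) (D≢0 : ¬ ℕ→ℚ d ≡ 0ℚ) (K L : Lattice) (conj-L : ImageIn conjMat L L) where

  private
    c∘ : Mat → Mat
    c∘ = compose conjMat

    c∘-injective : ∀ {σ τ} → c∘ σ ≡ c∘ τ → σ ≡ τ
    c∘-injective {σ} {τ} e = trans (sym (conjMat-involutive σ)) (trans (cong c∘ e) (conjMat-involutive τ))

    c∘-image : ∀ {σ} → ImageIn σ K L → ImageIn (c∘ σ) K L
    c∘-image {σ} σK⊆L = ImageIn-compose conjMat σ K L L σK⊆L conj-L

    1≢-1 : ¬ 1ℚ ≡ - 1ℚ
    1≢-1 ()

    c∘-InO⁺ : ∀ {σ} → InO d σ → det σ ≡ - 1ℚ → InO⁺ d (c∘ σ)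
    c∘-InO⁺ {σ} σ∈O det≡-1 =
      InO-compose d conjMat σ (conjMat-InO d) σ∈O , trans (det-conjMat∘ σ) (cong (- 1ℚ *_) det≡-1)

    proper≢c∘proper : ∀ {σ τ} → det σ ≡ 1ℚ → det τ ≡ 1ℚ → ¬ σ ≡ c∘ τ
    proper≢c∘proper {σ} {τ} detσ≡1 detτ≡1 σ≡cτ =
      1≢-1 (trans (sym detσ≡1) (trans (cong det σ≡cτ) (trans (det-conjMat∘ τ) (cong (- 1ℚ *_) detτ≡1))))

  hasCard-InO-double : ∀ {m} → HasCard (λ σ → InO⁺ d σ × ImageIn σ K L) _≡_ m →
                       HasCard (λ σ → InO d σ × ImageIn σ K L) _≡_ (m ℕ.+ m)
  hasCard-InO-double {m} (σs , refl , σs-proper , complete , unique) =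
    σs ++ map c∘ σs ,
    trans (length-++ σs) (cong (m ℕ.+_) (length-map c∘ σs)) ,
    All.++⁺ (All.map (λ {σ} → forget-det {σ}) σs-proper) (All.map⁺ (All.map (λ {σ} → c∘-counted {σ}) σs-proper)) ,
    complete′ ,
    AllPairs.++⁺ unique (AllPairs.map⁺ (AllPairs.map (λ {σ} {τ} σ≢τ e → σ≢τ (c∘-injective {σ} {τ} e)) unique))
      (All.map (λ {σ} ((_ , detσ≡1) , _) →
                  All.map⁺ (All.map (λ {τ} ((_ , detτ≡1) , _) → proper≢c∘proper {σ} {τ} detσ≡1 detτ≡1) σs-proper))
               σs-proper)
    where
    forget-det : ∀ {σ} → InO⁺ d σ × ImageIn σ K L → InO d σ × ImageIn σ K L
    forget-det ((σ∈O , _) , σK⊆L) = σ∈O , σK⊆L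
    c∘-counted : ∀ {σ} → InO⁺ d σ × ImageIn σ K L → InO d (c∘ σ) × ImageIn (c∘ σ) K L
    c∘-counted {σ} ((σ∈O , _) , σK⊆L) = InO-compose d conjMat σ (conjMat-InO d) σ∈O , c∘-image {σ} σK⊆L
    complete′ : ∀ σ → InO d σ × ImageIn σ K L → Any.Any (σ ≡_) (σs ++ map c∘ σs)
    complete′ σ (σ∈O , σK⊆L) = by-det (Orthogonal.det≡±1 d σ σ∈O D≢0)
      where
      by-det : det σ ≡ 1ℚ ⊎ det σ ≡ - 1ℚ → Any.Any (σ ≡_) (σs ++ map c∘ σs)
      by-det (inj₁ det≡1)  = Any.++⁺ˡ (complete σ ((σ∈O , det≡1) , σK⊆L))
      by-det (inj₂ det≡-1) = Any.++⁺ʳ σs (Any.map⁺ (Any.map (λ cσ≡τ → trans (sym (conjMat-involutive σ)) (cong c∘ cσ≡τ))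
                               (complete (c∘ σ) (c∘-InO⁺ {σ} σ∈O det≡-1 , c∘-image {σ} σK⊆L))))

-- Orders ℤ[ω] ⊆ ℚ(√-d) with ω² = t ω - 1, t ∈ {0, 1}

record QuadraticOrder (d : ℕ) : Set where
  field
    ω              : F
    ω-independent  : ¬ det (mat 1ℚ (proj₁ ω) 0ℚ (proj₂ ω)) ≡ 0ℚ
    trace          : ℤ
    trace-small    : trace ≡ + 0 ⊎ trace ≡ + 1
    ω²             : mulF d ω ω ≡ (ℤ→ℚ trace · ω) ⊖ 1F
    ℤ²⊆R           : ∀ a b → (ℤ→ℚ a , ℤ→ℚ b) ∈L lattice 1F ω ω-independent
    half-integral  : ∀ v → v ∈L lattice 1F ω ω-independent →
                     IsInteger (ℤ→ℚ (+ 2) * proj₁ v) × IsInteger (ℤ→ℚ (+ 2) * proj₂ v)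
    conj-stable    : ImageIn conjMat (lattice 1F ω ω-independent) (lattice 1F ω ω-independent)

  R : Lattice
  R = lattice 1F ω ω-independent

-- Isometries mapping a lattice into R

norm-bound : ∀ d {{_ : NonZero d}} i j B → i ℤ.* i ℤ.+ + d ℤ.* (j ℤ.* j) ≡ + B ℤ.* + B →
             ℤ.∣ i ∣ ≤ B × ℤ.∣ j ∣ ≤ B
norm-bound d i j B norm≡ =
  m*m≤n*n⇒m≤n I B (subst (I ℕ.* I ≤_) sum≡B² (ℕ.m≤m+n (I ℕ.* I) (d ℕ.* (J ℕ.* J)))) ,
  m*m≤n*n⇒m≤n J B (subst (J ℕ.* J ≤_) sum≡B²
    (ℕ.≤-trans (ℕ.m≤n*m (J ℕ.* J) d) (ℕ.m≤n+m (d ℕ.* (J ℕ.* J)) (I ℕ.* I))))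
  where
  I = ℤ.∣ i ∣
  J = ℤ.∣ j ∣
  sum≡B² : I ℕ.* I ℕ.+ d ℕ.* (J ℕ.* J) ≡ B ℕ.* B
  sum≡B² = ℤ.+-injective (trans (sym (sum-of-squares i d j)) (trans norm≡ (sym (ℤ.pos-* B B))))

symmetricRange : ℕ → List ℤ
symmetricRange zero    = + 0 ∷ []
symmetricRange (suc B) = + suc B ∷ -[1+ B ] ∷ symmetricRange B

∈-symmetricRange : ∀ B i → ℤ.∣ i ∣ ≤ B → i ∈ symmetricRange B
∈-symmetricRange zero    (+ zero)   _ = here refl
∈-symmetricRange (suc B) (+ n)      n≤1+B with n ℕ.≟ suc B
... | yes refl = here refl
... | no  n≢   = there (there (∈-symmetricRange B (+ n) (ℕ.≤-pred (ℕ.≤∧≢⇒< n≤1+B n≢))))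
∈-symmetricRange (suc B) -[1+ n ]   1+n≤1+B with n ℕ.≟ B
... | yes refl = there (here refl)
... | no  n≢   = there (there (∈-symmetricRange B -[1+ n ] (ℕ.≤∧≢⇒< (ℕ.≤-pred 1+n≤1+B) n≢)))

module ProperImages {d : ℕ} {{_ : NonZero d}} (𝒪 : QuadraticOrder d) where

  open QuadraticOrder 𝒪

  -- If (1+M)·1 ∈ K and σ ∈ O⁺ is multiplication by a + b√-d, then σ(K) ⊆ R ⊆ ½ℤ² makes 2(1+M)a and
  -- 2(1+M)b integers, of absolute value at most 2(1+M) because a² + d b² = 1.
  module _ (M : ℕ) where

    private
      D = ℕ→ℚ d
      P = ℤ→ℚ (+ suc M)
      B = 2 ℕ.* suc M
      2P = ℤ→ℚ (+ 2) * P
      2P≢0 : ¬ 2P ≡ 0ℚ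
      2P≢0 = *-≢0 (ℤ→ℚ-suc≢0 1) (ℤ→ℚ-suc≢0 M)
      T = ℚ.1/_ 2P {{ℚ.≢-nonZero 2P≢0}}

      candidate : ℤ × ℤ → Mat
      candidate (i , j) = multMat d (ℤ→ℚ i * T , ℤ→ℚ j * T)

      coefficient : ∀ i a → 2P * a ≡ ℤ→ℚ i → a ≡ ℤ→ℚ i * T
      coefficient i a 2Pa≡i = begin
        a                 ≡⟨ ℚ.*-identityˡ a ⟨
        1ℚ * a            ≡⟨ cong (_* a) (ℚ.*-inverseʳ 2P {{ℚ.≢-nonZero 2P≢0}}) ⟨
        (2P * T) * a      ≡⟨ identity 2P T a ⟩
        (2P * a) * T      ≡⟨ cong (_* T) 2Pa≡i ⟩
        ℤ→ℚ i * T         ∎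
        where
        open ≡-Reasoning
        identity : ∀ x t a → (x * t) * a ≡ (x * a) * t
        identity = solve-∀ ℚ-ring

      integral-norm : ∀ i j a b → 2P * a ≡ ℤ→ℚ i → 2P * b ≡ ℤ→ℚ j → a * a + D * (b * b) ≡ 1ℚ →
                      i ℤ.* i ℤ.+ + d ℤ.* (j ℤ.* j) ≡ + B ℤ.* + B
      integral-norm i j a b 2Pa≡i 2Pb≡j Nab≡1 = ℤ→ℚ-injective (begin
        ℤ→ℚ (i ℤ.* i ℤ.+ + d ℤ.* (j ℤ.* j))      ≡⟨ ℤ→ℚ-lincomb i i (+ d) (j ℤ.* j) ⟩
        ℤ→ℚ i * ℤ→ℚ i + D * ℤ→ℚ (j ℤ.* j)        ≡⟨ cong (λ x → ℤ→ℚ i * ℤ→ℚ i + D * x) (ℤ→ℚ-* j j) ⟩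
        ℤ→ℚ i * ℤ→ℚ i + D * (ℤ→ℚ j * ℤ→ℚ j)      ≡⟨ cong₂ (λ x y → x * x + D * (y * y)) 2Pa≡i 2Pb≡j ⟨
        (2P * a) * (2P * a) + D * ((2P * b) * (2P * b)) ≡⟨ identity 2P a b D ⟩
        (2P * 2P) * (a * a + D * (b * b))         ≡⟨ cong ((2P * 2P) *_) Nab≡1 ⟩
        (2P * 2P) * 1ℚ                            ≡⟨ ℚ.*-identityʳ (2P * 2P) ⟩
        2P * 2P                                   ≡⟨ cong₂ _*_ (ℤ→ℚ-* (+ 2) (+ suc M)) (ℤ→ℚ-* (+ 2) (+ suc M)) ⟨
        ℤ→ℚ (+ B) * ℤ→ℚ (+ B)                     ≡⟨ ℤ→ℚ-* (+ B) (+ B) ⟨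
        ℤ→ℚ (+ B ℤ.* + B)                         ∎)
        where
        open ≡-Reasoning
        identity : ∀ x a b D → (x * a) * (x * a) + D * ((x * b) * (x * b)) ≡ (x * x) * (a * a + D * (b * b))
        identity = solve-∀ ℚ-ring

    candidates : List Mat
    candidates = map candidate (cartesianProduct (symmetricRange B) (symmetricRange B))

    candidates-complete : ∀ σ → InO⁺ d σ → apply σ (point R (+ suc M) (+ 0)) ∈L R → σ ∈ candidates
    candidates-complete σ (σ∈O , det≡1) σP∈R =
      Any.map (trans σ≡candidate)
        (∈.∈-map⁺ candidate (∈.∈-cartesianProduct⁺ (∈-symmetricRange B i (proj₁ bounds))
                                                    (∈-symmetricRange B j (proj₂ bounds))))
      where
      open Orthogonal d σ σ∈O
      a = Mat.m11 σ
      b = Mat.m21 σ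
      w₁ = proj₁ ω
      w₂ = proj₂ ω
      i = proj₁ (proj₁ (half-integral _ σP∈R))
      j = proj₁ (proj₂ (half-integral _ σP∈R))
      image : ∀ p q P w₁ w₂ → p * (P * 1ℚ + 0ℚ * w₁) + q * (P * 0ℚ + 0ℚ * w₂) ≡ P * p
      image = solve-∀ ℚ-ring
      2Pa≡i : 2P * a ≡ ℤ→ℚ i
      2Pa≡i = trans (ℚ.*-assoc (ℤ→ℚ (+ 2)) P a)
        (trans (cong (ℤ→ℚ (+ 2) *_) (sym (image a (Mat.m12 σ) P w₁ w₂))) (proj₂ (proj₁ (half-integral _ σP∈R))))
      2Pb≡j : 2P * b ≡ ℤ→ℚ j
      2Pb≡j = trans (ℚ.*-assoc (ℤ→ℚ (+ 2)) P b)
        (trans (cong (ℤ→ℚ (+ 2) *_) (sym (image b (Mat.m22 σ) P w₁ w₂))) (proj₂ (proj₂ (half-integral _ σP∈R))))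
      bounds = norm-bound d i j B (integral-norm i j a b 2Pa≡i 2Pb≡j column₁-norm)
      σ≡candidate : σ ≡ candidate (i , j)
      σ≡candidate = trans (Proper.≡multMat det≡1)
        (cong (multMat d) (cong₂ _,_ (coefficient i a 2Pa≡i) (coefficient j b 2Pb≡j)))

  abstract
    hasCard-proper-images : ∀ K M → point R (+ suc M) (+ 0) ∈L K →
                            ∃ (HasCard (λ σ → InO⁺ d σ × ImageIn σ K R) _≡_)
    hasCard-proper-images K M P∈K =
      hasCard-filter (decSetoid mat-≟) (λ σ → InO⁺? d σ ×-dec ImageIn? σ K R) (λ { refl counted → counted })
        (candidates M) (λ σ (σ∈O⁺ , σK⊆R) → candidates-complete M σ σ∈O⁺ (σK⊆R _ P∈K))

-- The coefficients of Z_{R,ρ} and Z⁺_{R,ρ}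

HasIndex-resp : ∀ L K K′ {n} → K ≐L K′ → HasIndex L K n → HasIndex L K′ n
HasIndex-resp L K K′ (K⊆K′ , K′⊆K) =
  hasCard-resp id id (λ {u} {v} → K⊆K′ (u ⊖ v)) (λ {u} {v} → K′⊆K (u ⊖ v))

HasIndex-unique : ∀ L K {m n} → HasIndex L K m → HasIndex L K n → m ≡ n
HasIndex-unique L K = hasCard-unique (λ {u} {v} → congruent-sym K {u} {v}) (λ {u} {v} {w} → congruent-trans K {u} {v} {w})

module Sublattices (L : Lattice) (ρ : Mat) (ρ-finite : FiniteOrder ρ) (n : ℕ) where

  HasIndex? : ∀ K → K ⊆L L → Dec (HasIndex L K n)
  HasIndex? K K⊆L = map′
    (λ n≡ → HasIndex-resp L (hnf L p q r) K (≐L-sym {K} {hnf L p q r} K≐hnf)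
              (subst (HasIndex L (hnf L p q r)) (sym n≡) (hnf-index L p q r)))
    (λ index → HasIndex-unique L (hnf L p q r) (HasIndex-resp L K (hnf L p q r) K≐hnf index) (hnf-index L p q r))
    (n ℕ.≟ suc p ℕ.* suc r)
    where
    open HermiteNormalForm L K K⊆L
    p = proj₁ hermite-normal-form
    q = proj₁ (proj₂ hermite-normal-form)
    r = proj₁ (proj₂ (proj₂ hermite-normal-form))
    K≐hnf : K ≐L hnf L p q r
    K≐hnf = proj₂ (proj₂ (proj₂ (proj₂ hermite-normal-form)))

  module _ (inG : Mat → Set) where

    Counted? : ∀ K → Dec (Counted inG L ρ n K)
    Counted? K = by-inclusion (K ⊆L? L)
      where
      by-inclusion : Dec (K ⊆L L) → Dec (Counted inG L ρ n K)
      by-inclusion (no  K⊈L) = no λ (K⊆L , _) → K⊈L K⊆L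
      by-inclusion (yes K⊆L) =
        map′ (λ (index , stable) → K⊆L , index , stable) proj₂ (HasIndex? K K⊆L ×-dec Stable? ρ ρ-finite K)

    Counted-resp : ∀ {K K′} → K ≐L K′ → Counted inG L ρ n K → Counted inG L ρ n K′
    Counted-resp {K} {K′} K≐K′@(_ , K′⊆K) (K⊆L , index , stable) =
      ⊆L-trans {K′} {K} {L} K′⊆K K⊆L , HasIndex-resp L K K′ K≐K′ index , Stable-resp ρ {K} {K′} K≐K′ stable

    -- A counted K is some hnf L p q r with (1+p)(1+r) = n, so p, q, r < n.
    hnf-uncurried : ℕ × ℕ × ℕ → Lattice
    hnf-uncurried (p , q , r) = hnf L p q r

    hnf-candidates : List Lattice
    hnf-candidates = map hnf-uncurried (cartesianProduct (downFrom n) (cartesianProduct (downFrom n) (downFrom n)))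

    hnf-candidates-complete : ∀ K → Counted inG L ρ n K → Any.Any (K ≐L_) hnf-candidates
    hnf-candidates-complete K (K⊆L , index , _) =
      Any.map (λ {K′} hnf≡K′ → subst (K ≐L_) hnf≡K′ K≐hnf) (∈.∈-map⁺ hnf-uncurried pqr∈)
      where
      open HermiteNormalForm L K K⊆L
      p = proj₁ hermite-normal-form
      q = proj₁ (proj₂ hermite-normal-form)
      r = proj₁ (proj₂ (proj₂ hermite-normal-form))
      q<1+p = proj₁ (proj₂ (proj₂ (proj₂ hermite-normal-form)))
      K≐hnf : K ≐L hnf L p q r
      K≐hnf = proj₂ (proj₂ (proj₂ (proj₂ hermite-normal-form)))
      n≡ : n ≡ suc p ℕ.* suc r
      n≡ = HasIndex-unique L K index (HasIndex-resp L (hnf L p q r) K (≐L-sym {K} {hnf L p q r} K≐hnf) (hnf-index L p q r))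
      1+p≤n : suc p ℕ.≤ n
      1+p≤n = subst (suc p ℕ.≤_) (sym n≡) (ℕ.m≤m*n (suc p) (suc r))
      p<n : p < n
      p<n = 1+p≤n
      q<n : q < n
      q<n = ℕ.<-≤-trans q<1+p 1+p≤n
      r<n : r < n
      r<n = subst (suc r ℕ.≤_) (sym n≡) (ℕ.m≤n*m (suc r) (suc p))
      pqr∈ : (p , q , r) ∈ cartesianProduct (downFrom n) (cartesianProduct (downFrom n) (downFrom n))
      pqr∈ = ∈.∈-cartesianProduct⁺ (∈.∈-downFrom⁺ p<n) (∈.∈-cartesianProduct⁺ (∈.∈-downFrom⁺ q<n) (∈.∈-downFrom⁺ r<n))

    abstract
      counted-sublattices : ∃ (HasCard (Counted inG L ρ n) _≐L_)
      counted-sublattices = hasCard-filter ≐L-decSetoid Counted? (λ {K} {K′} → Counted-resp {K} {K′})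
        hnf-candidates hnf-candidates-complete

Weight : (Mat → Set) → Lattice → Lattice → ℚ → Set
Weight inG L K w = Σ ℕ λ m → HasCard (λ σ → inG σ × ImageIn σ K L) _≡_ m × w * ℕ→ℚ m ≡ 1ℚ

inverse-of-count : ∀ {A : Set} {P : A → Set} {_≈_ : A → A → Set} {m} → HasCard P _≈_ m → ∀ a → P a →
                   Σ ℚ λ w → w * ℕ→ℚ m ≡ 1ℚ
inverse-of-count {m = m} card a Pa = invert (hasCard-nonempty card a Pa)
  where
  invert : ∃ (λ k → m ≡ suc k) → Σ ℚ λ w → w * ℕ→ℚ m ≡ 1ℚ
  invert (k , refl) = ℚ.1/_ (ℕ→ℚ (suc k)) {{ℚ.≢-nonZero (ℤ→ℚ-suc≢0 k)}} ,
                      ℚ.*-inverseˡ (ℕ→ℚ (suc k)) {{ℚ.≢-nonZero (ℤ→ℚ-suc≢0 k)}}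

halved-weight : ∀ w m → w * ℕ→ℚ m ≡ 1ℚ → (½ * w) * ℕ→ℚ (m ℕ.+ m) ≡ 1ℚ
halved-weight w m w*m≡1 = begin
  (½ * w) * ℕ→ℚ (m ℕ.+ m)        ≡⟨ cong ((½ * w) *_) (ℕ→ℚ-+ m m) ⟩
  (½ * w) * (ℕ→ℚ m + ℕ→ℚ m)      ≡⟨ identity w (ℕ→ℚ m) ⟩
  w * ℕ→ℚ m                      ≡⟨ w*m≡1 ⟩
  1ℚ                             ∎
  where
  open ≡-Reasoning
  identity : ∀ w x → (½ * w) * (x + x) ≡ w * x
  identity = solve-∀ ℚ-ring

sumℚ-½* : ∀ ws → sumℚ (map (½ *_) ws) ≡ ½ * sumℚ ws
sumℚ-½* []       = sym (ℚ.*-zeroʳ ½)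
sumℚ-½* (w ∷ ws) = trans (cong (λ x → ½ * w + x) (sumℚ-½* ws)) (sym (ℚ.*-distribˡ-+ ½ w (sumℚ ws)))

module CoefficientsOfR {d : ℕ} {{_ : NonZero d}} (𝒪 : QuadraticOrder d) (ρ : Mat) (ρ-finite : FiniteOrder ρ) (n : ℕ) where

  open QuadraticOrder 𝒪
  open ProperImages 𝒪

  private
    D≢0 : ¬ ℕ→ℚ d ≡ 0ℚ
    D≢0 D≡0 = ℕ.≢-nonZero⁻¹ d (ℤ.+-injective (ℤ→ℚ-injective D≡0))

    weights : ∀ Ks → All (λ K → K ⊆L R) Ks →
      Σ (List ℚ) λ ws → Pointwise (Weight (InO⁺ d) R) Ks ws × Pointwise (Weight (InO d) R) Ks (map (½ *_) ws)
    weights []       []             = [] , [] , []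
    weights (K ∷ Ks) (K⊆R ∷ Ks⊆R) =
      w ∷ ws ,
      (m , proper , w*m≡1) ∷ proper-weights ,
      (m ℕ.+ m , hasCard-InO-double d D≢0 K R conj-stable proper , halved-weight w m w*m≡1) ∷ weights′
      where
      open HermiteNormalForm R K K⊆R using (diagonal∈K)
      proper-count = hasCard-proper-images K (proj₁ diagonal∈K) (proj₁ (proj₂ diagonal∈K))
      m = proj₁ proper-count
      proper = proj₂ proper-count
      inverse = inverse-of-count proper idMat (idMat-InO⁺ d , λ v v∈K → subst (_∈L R) (sym (apply-idMat v)) (K⊆R v v∈K))
      w = proj₁ inverse
      w*m≡1 : w * ℕ→ℚ m ≡ 1ℚ
      w*m≡1 = proj₂ inverse
      rest = weights Ks Ks⊆R
      ws = proj₁ rest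
      proper-weights = proj₁ (proj₂ rest)
      weights′ = proj₂ (proj₂ rest)

  coefficients : Σ ℚ λ c → Σ ℚ λ c⁺ → ZCoeff (InO d) R ρ n c × ZCoeff (InO⁺ d) R ρ n c⁺ × c ≡ ½ * c⁺
  coefficients =
    sumℚ (map (½ *_) ws) , sumℚ ws ,
    (Ks , counted , complete , unique , map (½ *_) ws , weights-O , refl) ,
    (Ks , counted , complete , unique , ws , weights-O⁺ , refl) ,
    sumℚ-½* ws
    where
    Ks-card = proj₂ (Sublattices.counted-sublattices R ρ ρ-finite n (InO d))
    Ks = proj₁ Ks-card
    counted = proj₁ (proj₂ (proj₂ Ks-card))
    complete = proj₁ (proj₂ (proj₂ (proj₂ Ks-card)))
    unique = proj₂ (proj₂ (proj₂ (proj₂ Ks-card)))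
    Ks-weights = weights Ks (All.map proj₁ counted)
    ws = proj₁ Ks-weights
    weights-O⁺ = proj₁ (proj₂ Ks-weights)
    weights-O = proj₂ (proj₂ Ks-weights)

-- Euclid's algorithm in ℤ[ω]

RoundedDivision : ℤ → ℕ → Set
RoundedDivision z M = ∃₂ λ q r → z ≡ q ℤ.* + M ℤ.+ r × ℤ.∣ r ∣ ℕ.+ ℤ.∣ r ∣ ≤ M

abstract
  rounded-division : ∀ z M .{{_ : NonZero M}} → RoundedDivision z M
  rounded-division z M = by-size (ρ ℕ.+ ρ ℕ.≤? M)
    where
    ρ : ℕ
    ρ = z %ℕ M
    ρ<M : ρ < M
    ρ<M = n%ℕd<d z M
    z≡ρ+qM : z ≡ + ρ ℤ.+ (z /ℕ M) ℤ.* + M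
    z≡ρ+qM = a≡a%ℕn+[a/ℕn]*n z M
    by-size : Dec (ρ ℕ.+ ρ ≤ M) → RoundedDivision z M
    by-size (yes 2ρ≤M) = z /ℕ M , + ρ , trans z≡ρ+qM (ℤ.+-comm (+ ρ) (z /ℕ M ℤ.* + M)) , 2ρ≤M
    by-size (no  2ρ≰M) = z /ℕ M ℤ.+ + 1 , + ρ ℤ.- + M , trans z≡ρ+qM (identity (+ ρ) (z /ℕ M) (+ M)) , bound
      where
      identity : ∀ ρ q M → ρ ℤ.+ q ℤ.* M ≡ (q ℤ.+ + 1) ℤ.* M ℤ.+ (ρ ℤ.- M)
      identity = ℤ-Solver.solve-∀
      ∣ρ-M∣≡ : ℤ.∣ + ρ ℤ.- + M ∣ ≡ M ℕ.∸ ρ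
      ∣ρ-M∣≡ = trans (cong ℤ.∣_∣ (ℤ.m-n≡m⊖n ρ M)) (ℤ.∣⊖∣-< ρ<M)
      bound : ℤ.∣ + ρ ℤ.- + M ∣ ℕ.+ ℤ.∣ + ρ ℤ.- + M ∣ ≤ M
      bound = begin
        ℤ.∣ + ρ ℤ.- + M ∣ ℕ.+ ℤ.∣ + ρ ℤ.- + M ∣   ≡⟨ cong₂ ℕ._+_ ∣ρ-M∣≡ ∣ρ-M∣≡ ⟩
        (M ℕ.∸ ρ) ℕ.+ (M ℕ.∸ ρ)                   ≤⟨ ℕ.+-monoʳ-≤ (M ℕ.∸ ρ) (ℕ.m≤n+o⇒m∸n≤o M ρ (ℕ.<⇒≤ (ℕ.≰⇒> 2ρ≰M))) ⟩
        (M ℕ.∸ ρ) ℕ.+ ρ                           ≡⟨ ℕ.m∸n+n≡m (ℕ.<⇒≤ ρ<M) ⟩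
        M                                         ∎
        where open ℕ.≤-Reasoning

-- (m , n) stands for m + n ω, where ω² = t ω - 1.
ℤ² : Set
ℤ² = ℤ × ℤ

normℤ : ℤ → ℤ² → ℤ
normℤ t (m , n) = m ℤ.* m ℤ.+ t ℤ.* (m ℤ.* n) ℤ.+ n ℤ.* n

private
  square≡0 : ∀ i → ℤ.∣ i ∣ ℕ.* ℤ.∣ i ∣ ≡ 0 → i ≡ + 0
  square≡0 i ∣i∣²≡0 with ℕ.m*n≡0⇒m≡0∨n≡0 ℤ.∣ i ∣ ∣i∣²≡0
  ... | inj₁ ∣i∣≡0 = ℤ.∣i∣≡0⇒i≡0 ∣i∣≡0
  ... | inj₂ ∣i∣≡0 = ℤ.∣i∣≡0⇒i≡0 ∣i∣≡0

  squares≡0 : ∀ c .{{_ : NonZero c}} s n → ℤ.∣ s ∣ ℕ.* ℤ.∣ s ∣ ℕ.+ c ℕ.* (ℤ.∣ n ∣ ℕ.* ℤ.∣ n ∣) ≡ 0 →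
              s ≡ + 0 × n ≡ + 0
  squares≡0 c s n sum≡0 =
    square≡0 s (ℕ.m+n≡0⇒m≡0 (ℤ.∣ s ∣ ℕ.* ℤ.∣ s ∣) sum≡0) ,
    square≡0 n (ℕ.*-cancelˡ-≡ (ℤ.∣ n ∣ ℕ.* ℤ.∣ n ∣) 0 c (trans (ℕ.m+n≡0⇒n≡0 (ℤ.∣ s ∣ ℕ.* ℤ.∣ s ∣) sum≡0) (sym (ℕ.*-zeroʳ c))))

  2*≡0 : ∀ m → + 2 ℤ.* m ≡ + 0 → m ≡ + 0
  2*≡0 m 2m≡0 with ℤ.i*j≡0⇒i≡0∨j≡0 (+ 2) 2m≡0
  ... | inj₁ ()
  ... | inj₂ m≡0 = m≡0

-- 4 N(m + n ω) = (2m + t n)² + (4 - t²) n² is a positive definite sum of squares.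
four-norm : ∀ t → t ≡ + 0 ⊎ t ≡ + 1 → ∀ y → ∃ λ K → + 4 ℤ.* normℤ t y ≡ + K × (K ≡ 0 → y ≡ (+ 0 , + 0))
four-norm _ (inj₁ refl) (m , n) = _ , trans (identity m n) (sum-of-squares (+ 2 ℤ.* m) 4 n) , λ K≡0 →
  let 2m≡0 , n≡0 = squares≡0 4 (+ 2 ℤ.* m) n K≡0 in cong₂ _,_ (2*≡0 m 2m≡0) n≡0
  where
  identity : ∀ m n → + 4 ℤ.* (m ℤ.* m ℤ.+ + 0 ℤ.* (m ℤ.* n) ℤ.+ n ℤ.* n)
                     ≡ (+ 2 ℤ.* m) ℤ.* (+ 2 ℤ.* m) ℤ.+ + 4 ℤ.* (n ℤ.* n)
  identity = ℤ-Solver.solve-∀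
four-norm _ (inj₂ refl) (m , n) = _ , trans (identity m n) (sum-of-squares (+ 2 ℤ.* m ℤ.+ n) 3 n) , λ K≡0 →
  let s≡0 , n≡0 = squares≡0 3 (+ 2 ℤ.* m ℤ.+ n) n K≡0
  in cong₂ _,_ (2*≡0 m (trans (sym (ℤ.+-identityʳ _)) (trans (cong (λ n → + 2 ℤ.* m ℤ.+ n) (sym n≡0)) s≡0))) n≡0
  where
  identity : ∀ m n → + 4 ℤ.* (m ℤ.* m ℤ.+ + 1 ℤ.* (m ℤ.* n) ℤ.+ n ℤ.* n)
                     ≡ (+ 2 ℤ.* m ℤ.+ n) ℤ.* (+ 2 ℤ.* m ℤ.+ n) ℤ.+ + 3 ℤ.* (n ℤ.* n)
  identity = ℤ-Solver.solve-∀

module EuclideanDomain (t : ℤ) (t-small : t ≡ + 0 ⊎ t ≡ + 1) where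

  infixl 7 _⊠_
  infixl 6 _⊞_ _⊟_
  infix  4 _∣_

  _⊠_ _⊞_ _⊟_ : ℤ² → ℤ² → ℤ²
  (m , n) ⊠ (m′ , n′) = (m ℤ.* m′ ℤ.- n ℤ.* n′ , m ℤ.* n′ ℤ.+ n ℤ.* m′ ℤ.+ t ℤ.* (n ℤ.* n′))
  (m , n) ⊞ (m′ , n′) = (m ℤ.+ m′ , n ℤ.+ n′)
  (m , n) ⊟ (m′ , n′) = (m ℤ.- m′ , n ℤ.- n′)

  pattern 0# = (+ 0 , + 0)
  pattern 1# = (+ 1 , + 0)

  -- ω̄ = t - ω
  conj : ℤ² → ℤ²
  conj (m , n) = (m ℤ.+ t ℤ.* n , ℤ.- n)

  norm : ℤ² → ℤ
  norm = normℤ t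

  _∣_ : ℤ² → ℤ² → Set
  a ∣ b = ∃ λ c → b ≡ c ⊠ a

  ⊠-identityˡ : ∀ x → 1# ⊠ x ≡ x
  ⊠-identityˡ (x₁ , x₂) = cong₂ _,_ (first x₁ x₂) (second x₁ x₂ t)
    where
    first : ∀ x₁ x₂ → + 1 ℤ.* x₁ ℤ.- + 0 ℤ.* x₂ ≡ x₁
    first = ℤ-Solver.solve-∀
    second : ∀ x₁ x₂ t → + 1 ℤ.* x₂ ℤ.+ + 0 ℤ.* x₁ ℤ.+ t ℤ.* (+ 0 ℤ.* x₂) ≡ x₂
    second = ℤ-Solver.solve-∀

  ⊠-zeroˡ : ∀ x → 0# ⊠ x ≡ 0#
  ⊠-zeroˡ (x₁ , x₂) = cong₂ _,_ (first x₁ x₂) (second x₁ x₂ t)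
    where
    first : ∀ x₁ x₂ → + 0 ℤ.* x₁ ℤ.- + 0 ℤ.* x₂ ≡ + 0
    first = ℤ-Solver.solve-∀
    second : ∀ x₁ x₂ t → + 0 ℤ.* x₂ ℤ.+ + 0 ℤ.* x₁ ℤ.+ t ℤ.* (+ 0 ℤ.* x₂) ≡ + 0
    second = ℤ-Solver.solve-∀

  ⊞-identityʳ : ∀ x → x ⊞ 0# ≡ x
  ⊞-identityʳ (x₁ , x₂) = cong₂ _,_ (ℤ.+-identityʳ x₁) (ℤ.+-identityʳ x₂)

  norm-⊠ : ∀ a b → norm (a ⊠ b) ≡ norm a ℤ.* norm b
  norm-⊠ (a₁ , a₂) (b₁ , b₂) = identity a₁ a₂ b₁ b₂ t
    where
    identity : ∀ a₁ a₂ b₁ b₂ t →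
      let c₁ = a₁ ℤ.* b₁ ℤ.- a₂ ℤ.* b₂ ; c₂ = a₁ ℤ.* b₂ ℤ.+ a₂ ℤ.* b₁ ℤ.+ t ℤ.* (a₂ ℤ.* b₂) in
      c₁ ℤ.* c₁ ℤ.+ t ℤ.* (c₁ ℤ.* c₂) ℤ.+ c₂ ℤ.* c₂
        ≡ (a₁ ℤ.* a₁ ℤ.+ t ℤ.* (a₁ ℤ.* a₂) ℤ.+ a₂ ℤ.* a₂) ℤ.* (b₁ ℤ.* b₁ ℤ.+ t ℤ.* (b₁ ℤ.* b₂) ℤ.+ b₂ ℤ.* b₂)
    identity = ℤ-Solver.solve-∀

  norm-conj : ∀ a → norm (conj a) ≡ norm a
  norm-conj (a₁ , a₂) = identity a₁ a₂ t
    where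
    identity : ∀ a₁ a₂ t →
      (a₁ ℤ.+ t ℤ.* a₂) ℤ.* (a₁ ℤ.+ t ℤ.* a₂) ℤ.+ t ℤ.* ((a₁ ℤ.+ t ℤ.* a₂) ℤ.* ℤ.- a₂) ℤ.+ ℤ.- a₂ ℤ.* ℤ.- a₂
        ≡ a₁ ℤ.* a₁ ℤ.+ t ℤ.* (a₁ ℤ.* a₂) ℤ.+ a₂ ℤ.* a₂
    identity = ℤ-Solver.solve-∀

  ⊟⊠-conj : ∀ x q y → (x ⊟ q ⊠ y) ⊠ conj y ≡
    (proj₁ (x ⊠ conj y) ℤ.- proj₁ q ℤ.* norm y , proj₂ (x ⊠ conj y) ℤ.- proj₂ q ℤ.* norm y)
  ⊟⊠-conj (x₁ , x₂) (q₁ , q₂) (y₁ , y₂) = cong₂ _,_ (first x₁ x₂ q₁ q₂ y₁ y₂ t) (second x₁ x₂ q₁ q₂ y₁ y₂ t)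
    where
    first : ∀ x₁ x₂ q₁ q₂ y₁ y₂ t →
      (x₁ ℤ.- (q₁ ℤ.* y₁ ℤ.- q₂ ℤ.* y₂)) ℤ.* (y₁ ℤ.+ t ℤ.* y₂)
        ℤ.- (x₂ ℤ.- (q₁ ℤ.* y₂ ℤ.+ q₂ ℤ.* y₁ ℤ.+ t ℤ.* (q₂ ℤ.* y₂))) ℤ.* ℤ.- y₂
      ≡ (x₁ ℤ.* (y₁ ℤ.+ t ℤ.* y₂) ℤ.- x₂ ℤ.* ℤ.- y₂) ℤ.- q₁ ℤ.* (y₁ ℤ.* y₁ ℤ.+ t ℤ.* (y₁ ℤ.* y₂) ℤ.+ y₂ ℤ.* y₂)
    first = ℤ-Solver.solve-∀
    second : ∀ x₁ x₂ q₁ q₂ y₁ y₂ t →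
      (x₁ ℤ.- (q₁ ℤ.* y₁ ℤ.- q₂ ℤ.* y₂)) ℤ.* ℤ.- y₂
        ℤ.+ (x₂ ℤ.- (q₁ ℤ.* y₂ ℤ.+ q₂ ℤ.* y₁ ℤ.+ t ℤ.* (q₂ ℤ.* y₂))) ℤ.* (y₁ ℤ.+ t ℤ.* y₂)
        ℤ.+ t ℤ.* ((x₂ ℤ.- (q₁ ℤ.* y₂ ℤ.+ q₂ ℤ.* y₁ ℤ.+ t ℤ.* (q₂ ℤ.* y₂))) ℤ.* ℤ.- y₂)
      ≡ (x₁ ℤ.* ℤ.- y₂ ℤ.+ x₂ ℤ.* (y₁ ℤ.+ t ℤ.* y₂) ℤ.+ t ℤ.* (x₂ ℤ.* ℤ.- y₂))
          ℤ.- q₂ ℤ.* (y₁ ℤ.* y₁ ℤ.+ t ℤ.* (y₁ ℤ.* y₂) ℤ.+ y₂ ℤ.* y₂)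
    second = ℤ-Solver.solve-∀

  ∣norm∣ : ℤ² → ℕ
  ∣norm∣ y = ℤ.∣ norm y ∣

  norm≡∣norm∣ : ∀ y → norm y ≡ + ∣norm∣ y
  norm≡∣norm∣ y with norm y | four-norm t t-small y
  ... | + _      | _           = refl
  ... | -[1+ _ ] | _ , () , _

  ∣norm∣≡0 : ∀ y → ∣norm∣ y ≡ 0 → y ≡ 0#
  ∣norm∣≡0 y ∣N∣≡0 = let _ , 4N≡K , K≡0⇒y≡0 = four-norm t t-small y in
    K≡0⇒y≡0 (ℤ.+-injective (trans (sym 4N≡K) (cong (+ 4 ℤ.*_) (trans (norm≡∣norm∣ y) (cong +_ ∣N∣≡0)))))

  private
    ∣t∣≤1 : ℤ.∣ t ∣ ≤ 1
    ∣t∣≤1 = small⇒∣∣≤1 t-small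
      where
      small⇒∣∣≤1 : ∀ {t} → t ≡ + 0 ⊎ t ≡ + 1 → ℤ.∣ t ∣ ≤ 1
      small⇒∣∣≤1 (inj₁ refl) = z≤n
      small⇒∣∣≤1 (inj₂ refl) = s≤s z≤n

  remainder-norm : ∀ r₁ r₂ M → ℤ.∣ r₁ ∣ ℕ.+ ℤ.∣ r₁ ∣ ≤ M → ℤ.∣ r₂ ∣ ℕ.+ ℤ.∣ r₂ ∣ ≤ M →
                   4 ℕ.* ∣norm∣ (r₁ , r₂) ≤ 3 ℕ.* (M ℕ.* M)
  remainder-norm r₁ r₂ M 2a₁≤M 2a₂≤M = begin
    4 ℕ.* ∣norm∣ (r₁ , r₂)                          ≤⟨ ℕ.*-monoʳ-≤ 4 triangle ⟩
    4 ℕ.* (a₁ ℕ.* a₁ ℕ.+ a₁ ℕ.* a₂ ℕ.+ a₂ ℕ.* a₂)    ≡⟨ identity a₁ a₂ ⟩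
    (a₁ ℕ.+ a₁) ℕ.* (a₁ ℕ.+ a₁) ℕ.+ (a₁ ℕ.+ a₁) ℕ.* (a₂ ℕ.+ a₂) ℕ.+ (a₂ ℕ.+ a₂) ℕ.* (a₂ ℕ.+ a₂)
                                                    ≤⟨ ℕ.+-mono-≤ (ℕ.+-mono-≤ (ℕ.*-mono-≤ 2a₁≤M 2a₁≤M) (ℕ.*-mono-≤ 2a₁≤M 2a₂≤M))
                                                                  (ℕ.*-mono-≤ 2a₂≤M 2a₂≤M) ⟩
    M ℕ.* M ℕ.+ M ℕ.* M ℕ.+ M ℕ.* M                 ≡⟨ identity′ M ⟩
    3 ℕ.* (M ℕ.* M)                                 ∎
    where
    open ℕ.≤-Reasoning
    a₁ = ℤ.∣ r₁ ∣
    a₂ = ℤ.∣ r₂ ∣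
    identity : ∀ a₁ a₂ → 4 ℕ.* (a₁ ℕ.* a₁ ℕ.+ a₁ ℕ.* a₂ ℕ.+ a₂ ℕ.* a₂)
      ≡ (a₁ ℕ.+ a₁) ℕ.* (a₁ ℕ.+ a₁) ℕ.+ (a₁ ℕ.+ a₁) ℕ.* (a₂ ℕ.+ a₂) ℕ.+ (a₂ ℕ.+ a₂) ℕ.* (a₂ ℕ.+ a₂)
    identity = ℕ-Solver.solve-∀
    identity′ : ∀ M → M ℕ.* M ℕ.+ M ℕ.* M ℕ.+ M ℕ.* M ≡ 3 ℕ.* (M ℕ.* M)
    identity′ = ℕ-Solver.solve-∀
    triangle : ∣norm∣ (r₁ , r₂) ≤ a₁ ℕ.* a₁ ℕ.+ a₁ ℕ.* a₂ ℕ.+ a₂ ℕ.* a₂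
    triangle = begin
      ℤ.∣ r₁ ℤ.* r₁ ℤ.+ t ℤ.* (r₁ ℤ.* r₂) ℤ.+ r₂ ℤ.* r₂ ∣
        ≤⟨ ℤ.∣i+j∣≤∣i∣+∣j∣ (r₁ ℤ.* r₁ ℤ.+ t ℤ.* (r₁ ℤ.* r₂)) (r₂ ℤ.* r₂) ⟩
      ℤ.∣ r₁ ℤ.* r₁ ℤ.+ t ℤ.* (r₁ ℤ.* r₂) ∣ ℕ.+ ℤ.∣ r₂ ℤ.* r₂ ∣
        ≤⟨ ℕ.+-monoˡ-≤ ℤ.∣ r₂ ℤ.* r₂ ∣ (ℤ.∣i+j∣≤∣i∣+∣j∣ (r₁ ℤ.* r₁) (t ℤ.* (r₁ ℤ.* r₂))) ⟩
      ℤ.∣ r₁ ℤ.* r₁ ∣ ℕ.+ ℤ.∣ t ℤ.* (r₁ ℤ.* r₂) ∣ ℕ.+ ℤ.∣ r₂ ℤ.* r₂ ∣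
        ≡⟨ cong₂ (λ x y → x ℕ.+ y ℕ.+ ℤ.∣ r₂ ℤ.* r₂ ∣) (ℤ.abs-* r₁ r₁)
                 (trans (ℤ.abs-* t (r₁ ℤ.* r₂)) (cong (ℤ.∣ t ∣ ℕ.*_) (ℤ.abs-* r₁ r₂))) ⟩
      a₁ ℕ.* a₁ ℕ.+ ℤ.∣ t ∣ ℕ.* (a₁ ℕ.* a₂) ℕ.+ ℤ.∣ r₂ ℤ.* r₂ ∣
        ≤⟨ ℕ.+-mono-≤ (ℕ.+-monoʳ-≤ (a₁ ℕ.* a₁) (ℕ.≤-trans (ℕ.*-monoˡ-≤ (a₁ ℕ.* a₂) ∣t∣≤1) (ℕ.≤-reflexive (ℕ.*-identityˡ (a₁ ℕ.* a₂)))))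
                      (ℕ.≤-reflexive (ℤ.abs-* r₂ r₂)) ⟩
      a₁ ℕ.* a₁ ℕ.+ a₁ ℕ.* a₂ ℕ.+ a₂ ℕ.* a₂ ∎

  -- Round the coordinates of x ȳ / N(y) to the nearest integers.
  euclidean-division : ∀ x y {M} → ∣norm∣ y ≡ suc M → ∃ λ q → ∣norm∣ (x ⊟ q ⊠ y) < suc M
  euclidean-division x y {M} ∣N∣≡1+M = (q₁ , q₂) , n<M′
    where
    M′ = suc M
    z = x ⊠ conj y
    rounded₁ = rounded-division (proj₁ z) M′
    rounded₂ = rounded-division (proj₂ z) M′
    q₁ = proj₁ rounded₁
    r₁ = proj₁ (proj₂ rounded₁)
    q₂ = proj₁ rounded₂
    r₂ = proj₁ (proj₂ rounded₂)
    N≡M′ : norm y ≡ + M′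
    N≡M′ = trans (norm≡∣norm∣ y) (cong +_ ∣N∣≡1+M)
    remainder : ∀ {z q r} → z ≡ q ℤ.* + M′ ℤ.+ r → z ℤ.- q ℤ.* norm y ≡ r
    remainder {z} {q} {r} z≡ = trans (cong (λ N → z ℤ.- q ℤ.* N) N≡M′)
      (trans (cong (ℤ._- q ℤ.* + M′) z≡) (identity (q ℤ.* + M′) r))
      where
      identity : ∀ a r → (a ℤ.+ r) ℤ.- a ≡ r
      identity = ℤ-Solver.solve-∀
    r≡ : (x ⊟ (q₁ , q₂) ⊠ y) ⊠ conj y ≡ (r₁ , r₂)
    r≡ = trans (⊟⊠-conj x (q₁ , q₂) y)
      (cong₂ _,_ (remainder {proj₁ z} {q₁} {r₁} (proj₁ (proj₂ (proj₂ rounded₁))))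
                 (remainder {proj₂ z} {q₂} {r₂} (proj₁ (proj₂ (proj₂ rounded₂)))))
    n = ∣norm∣ (x ⊟ (q₁ , q₂) ⊠ y)
    n*M′≡ : n ℕ.* M′ ≡ ∣norm∣ (r₁ , r₂)
    n*M′≡ = begin
      n ℕ.* M′                                         ≡⟨ cong (λ N → n ℕ.* ℤ.∣ N ∣) (trans (norm-conj y) N≡M′) ⟨
      n ℕ.* ℤ.∣ norm (conj y) ∣                        ≡⟨ ℤ.abs-* (norm (x ⊟ (q₁ , q₂) ⊠ y)) (norm (conj y)) ⟨
      ℤ.∣ norm (x ⊟ (q₁ , q₂) ⊠ y) ℤ.* norm (conj y) ∣ ≡⟨ cong ℤ.∣_∣ (norm-⊠ (x ⊟ (q₁ , q₂) ⊠ y) (conj y)) ⟨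
      ∣norm∣ ((x ⊟ (q₁ , q₂) ⊠ y) ⊠ conj y)            ≡⟨ cong ∣norm∣ r≡ ⟩
      ∣norm∣ (r₁ , r₂)                                 ∎
      where open ≡-Reasoning
    4n≤3M′ : 4 ℕ.* n ≤ 3 ℕ.* M′
    4n≤3M′ = ℕ.*-cancelʳ-≤ (4 ℕ.* n) (3 ℕ.* M′) M′ (begin
      4 ℕ.* n ℕ.* M′        ≡⟨ ℕ.*-assoc 4 n M′ ⟩
      4 ℕ.* (n ℕ.* M′)      ≡⟨ cong (4 ℕ.*_) n*M′≡ ⟩
      4 ℕ.* ∣norm∣ (r₁ , r₂) ≤⟨ remainder-norm r₁ r₂ M′ (proj₂ (proj₂ (proj₂ rounded₁))) (proj₂ (proj₂ (proj₂ rounded₂))) ⟩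
      3 ℕ.* (M′ ℕ.* M′)     ≡⟨ ℕ.*-assoc 3 M′ M′ ⟨
      3 ℕ.* M′ ℕ.* M′       ∎)
      where open ℕ.≤-Reasoning
    n<M′ : n < M′
    n<M′ = 4*n≤3*m⇒n<m n M′ 4n≤3M′

  record GCD (x y : ℤ²) : Set where
    field
      gcd    : ℤ²
      gcd∣x  : gcd ∣ x
      gcd∣y  : gcd ∣ y
      bezout : ∃₂ λ u v → gcd ≡ u ⊠ x ⊞ v ⊠ y

  private
    gcd-zero : ∀ x → GCD x 0#
    gcd-zero x = record
      { gcd    = x
      ; gcd∣x  = 1# , sym (⊠-identityˡ x)
      ; gcd∣y  = 0# , sym (⊠-zeroˡ x)
      ; bezout = 1# , 0# , sym (trans (cong₂ _⊞_ (⊠-identityˡ x) (⊠-zeroˡ 0#)) (⊞-identityʳ x))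
      }

    ⊟⊞-cancel : ∀ a b → a ≡ (a ⊟ b) ⊞ b
    ⊟⊞-cancel (a₁ , a₂) (b₁ , b₂) = cong₂ _,_ (identity a₁ b₁) (identity a₂ b₂)
      where
      identity : ∀ a b → a ≡ (a ℤ.- b) ℤ.+ b
      identity = ℤ-Solver.solve-∀
    ⊠-collect : ∀ a q c g → a ⊠ g ⊞ q ⊠ (c ⊠ g) ≡ (a ⊞ q ⊠ c) ⊠ g
    ⊠-collect (a₁ , a₂) (q₁ , q₂) (c₁ , c₂) (g₁ , g₂) =
      cong₂ _,_ (first a₁ a₂ q₁ q₂ c₁ c₂ g₁ g₂ t) (second a₁ a₂ q₁ q₂ c₁ c₂ g₁ g₂ t)
      where
      first : ∀ a₁ a₂ q₁ q₂ c₁ c₂ g₁ g₂ t →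
        let cg₁ = c₁ ℤ.* g₁ ℤ.- c₂ ℤ.* g₂ ; cg₂ = c₁ ℤ.* g₂ ℤ.+ c₂ ℤ.* g₁ ℤ.+ t ℤ.* (c₂ ℤ.* g₂)
            s₁ = a₁ ℤ.+ (q₁ ℤ.* c₁ ℤ.- q₂ ℤ.* c₂) ; s₂ = a₂ ℤ.+ (q₁ ℤ.* c₂ ℤ.+ q₂ ℤ.* c₁ ℤ.+ t ℤ.* (q₂ ℤ.* c₂)) in
        (a₁ ℤ.* g₁ ℤ.- a₂ ℤ.* g₂) ℤ.+ (q₁ ℤ.* cg₁ ℤ.- q₂ ℤ.* cg₂) ≡ s₁ ℤ.* g₁ ℤ.- s₂ ℤ.* g₂
      first = ℤ-Solver.solve-∀
      second : ∀ a₁ a₂ q₁ q₂ c₁ c₂ g₁ g₂ t →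
        let cg₁ = c₁ ℤ.* g₁ ℤ.- c₂ ℤ.* g₂ ; cg₂ = c₁ ℤ.* g₂ ℤ.+ c₂ ℤ.* g₁ ℤ.+ t ℤ.* (c₂ ℤ.* g₂)
            s₁ = a₁ ℤ.+ (q₁ ℤ.* c₁ ℤ.- q₂ ℤ.* c₂) ; s₂ = a₂ ℤ.+ (q₁ ℤ.* c₂ ℤ.+ q₂ ℤ.* c₁ ℤ.+ t ℤ.* (q₂ ℤ.* c₂)) in
        (a₁ ℤ.* g₂ ℤ.+ a₂ ℤ.* g₁ ℤ.+ t ℤ.* (a₂ ℤ.* g₂)) ℤ.+ (q₁ ℤ.* cg₂ ℤ.+ q₂ ℤ.* cg₁ ℤ.+ t ℤ.* (q₂ ℤ.* cg₂))
          ≡ s₁ ℤ.* g₂ ℤ.+ s₂ ℤ.* g₁ ℤ.+ t ℤ.* (s₂ ℤ.* g₂)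
      second = ℤ-Solver.solve-∀
    bezout-shift : ∀ u v x q y → u ⊠ y ⊞ v ⊠ (x ⊟ q ⊠ y) ≡ v ⊠ x ⊞ (u ⊟ v ⊠ q) ⊠ y
    bezout-shift (u₁ , u₂) (v₁ , v₂) (x₁ , x₂) (q₁ , q₂) (y₁ , y₂) =
      cong₂ _,_ (first u₁ u₂ v₁ v₂ x₁ x₂ q₁ q₂ y₁ y₂ t) (second u₁ u₂ v₁ v₂ x₁ x₂ q₁ q₂ y₁ y₂ t)
      where
      first : ∀ u₁ u₂ v₁ v₂ x₁ x₂ q₁ q₂ y₁ y₂ t →
        let r₁ = x₁ ℤ.- (q₁ ℤ.* y₁ ℤ.- q₂ ℤ.* y₂) ; r₂ = x₂ ℤ.- (q₁ ℤ.* y₂ ℤ.+ q₂ ℤ.* y₁ ℤ.+ t ℤ.* (q₂ ℤ.* y₂))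
            s₁ = u₁ ℤ.- (v₁ ℤ.* q₁ ℤ.- v₂ ℤ.* q₂) ; s₂ = u₂ ℤ.- (v₁ ℤ.* q₂ ℤ.+ v₂ ℤ.* q₁ ℤ.+ t ℤ.* (v₂ ℤ.* q₂)) in
        (u₁ ℤ.* y₁ ℤ.- u₂ ℤ.* y₂) ℤ.+ (v₁ ℤ.* r₁ ℤ.- v₂ ℤ.* r₂)
          ≡ (v₁ ℤ.* x₁ ℤ.- v₂ ℤ.* x₂) ℤ.+ (s₁ ℤ.* y₁ ℤ.- s₂ ℤ.* y₂)
      first = ℤ-Solver.solve-∀
      second : ∀ u₁ u₂ v₁ v₂ x₁ x₂ q₁ q₂ y₁ y₂ t →
        let r₁ = x₁ ℤ.- (q₁ ℤ.* y₁ ℤ.- q₂ ℤ.* y₂) ; r₂ = x₂ ℤ.- (q₁ ℤ.* y₂ ℤ.+ q₂ ℤ.* y₁ ℤ.+ t ℤ.* (q₂ ℤ.* y₂))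
            s₁ = u₁ ℤ.- (v₁ ℤ.* q₁ ℤ.- v₂ ℤ.* q₂) ; s₂ = u₂ ℤ.- (v₁ ℤ.* q₂ ℤ.+ v₂ ℤ.* q₁ ℤ.+ t ℤ.* (v₂ ℤ.* q₂)) in
        (u₁ ℤ.* y₂ ℤ.+ u₂ ℤ.* y₁ ℤ.+ t ℤ.* (u₂ ℤ.* y₂)) ℤ.+ (v₁ ℤ.* r₂ ℤ.+ v₂ ℤ.* r₁ ℤ.+ t ℤ.* (v₂ ℤ.* r₂))
          ≡ (v₁ ℤ.* x₂ ℤ.+ v₂ ℤ.* x₁ ℤ.+ t ℤ.* (v₂ ℤ.* x₂)) ℤ.+ (s₁ ℤ.* y₂ ℤ.+ s₂ ℤ.* y₁ ℤ.+ t ℤ.* (s₂ ℤ.* y₂))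
      second = ℤ-Solver.solve-∀

    gcd-step : ∀ x y q → GCD y (x ⊟ q ⊠ y) → GCD x y
    gcd-step x y q record { gcd = g ; gcd∣x = c₁ , y≡c₁g ; gcd∣y = c₂ , r≡c₂g ; bezout = u , v , g≡ } = record
      { gcd    = g
      ; gcd∣x  = c₂ ⊞ q ⊠ c₁ , (begin
          x                       ≡⟨ ⊟⊞-cancel x (q ⊠ y) ⟩
          (x ⊟ q ⊠ y) ⊞ q ⊠ y     ≡⟨ cong₂ (λ r y → r ⊞ q ⊠ y) r≡c₂g y≡c₁g ⟩
          c₂ ⊠ g ⊞ q ⊠ (c₁ ⊠ g)   ≡⟨ ⊠-collect c₂ q c₁ g ⟩
          (c₂ ⊞ q ⊠ c₁) ⊠ g       ∎)
      ; gcd∣y  = c₁ , y≡c₁g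
      ; bezout = v , u ⊟ v ⊠ q , trans g≡ (bezout-shift u v x q y)
      }
      where open ≡-Reasoning

  abstract
    gcd : ∀ x y → GCD x y
    gcd x y = by-recursion x y (<-wellFounded (∣norm∣ y))
      where
      by-recursion : ∀ x y → Acc _<_ (∣norm∣ y) → GCD x y
      by-recursion x y (acc smaller) = by-norm (∣norm∣ y) refl
        where
        by-norm : ∀ N → ∣norm∣ y ≡ N → GCD x y
        by-norm zero    N≡0 = subst (GCD x) (sym (∣norm∣≡0 y N≡0)) (gcd-zero x)
        by-norm (suc M) N≡1+M =
          let q , r<1+M = euclidean-division x y N≡1+M
          in gcd-step x y q (by-recursion y (x ⊟ q ⊠ y) (smaller (subst (∣norm∣ (x ⊟ q ⊠ y) <_) (sym N≡1+M) r<1+M)))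

-- Multiplication by elements of F

module _ (d : ℕ) where

  private
    D = ℕ→ℚ d

  mulF-assoc : ∀ a b v → mulF d a (mulF d b v) ≡ mulF d (mulF d a b) v
  mulF-assoc (a₁ , a₂) (b₁ , b₂) (v₁ , v₂) = cong₂ _,_ (first a₁ a₂ b₁ b₂ v₁ v₂ D) (second a₁ a₂ b₁ b₂ v₁ v₂ D)
    where
    first : ∀ a₁ a₂ b₁ b₂ v₁ v₂ D →
      a₁ * (b₁ * v₁ - D * (b₂ * v₂)) - D * (a₂ * (b₁ * v₂ + b₂ * v₁))
        ≡ (a₁ * b₁ - D * (a₂ * b₂)) * v₁ - D * ((a₁ * b₂ + a₂ * b₁) * v₂)
    first = solve-∀ ℚ-ring
    second : ∀ a₁ a₂ b₁ b₂ v₁ v₂ D →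
      a₁ * (b₁ * v₂ + b₂ * v₁) + a₂ * (b₁ * v₁ - D * (b₂ * v₂))
        ≡ (a₁ * b₁ - D * (a₂ * b₂)) * v₂ + (a₁ * b₂ + a₂ * b₁) * v₁
    second = solve-∀ ℚ-ring

  mulF-comm : ∀ a b → mulF d a b ≡ mulF d b a
  mulF-comm (a₁ , a₂) (b₁ , b₂) = cong₂ _,_ (first a₁ a₂ b₁ b₂ D) (second a₁ a₂ b₁ b₂)
    where
    first : ∀ a₁ a₂ b₁ b₂ D → a₁ * b₁ - D * (a₂ * b₂) ≡ b₁ * a₁ - D * (b₂ * a₂)
    first = solve-∀ ℚ-ring
    second : ∀ a₁ a₂ b₁ b₂ → a₁ * b₂ + a₂ * b₁ ≡ b₁ * a₂ + b₂ * a₁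
    second = solve-∀ ℚ-ring

  mulF-identityˡ : ∀ v → mulF d 1F v ≡ v
  mulF-identityˡ (v₁ , v₂) = cong₂ _,_ (first v₁ v₂ D) (second v₁ v₂)
    where
    first : ∀ v₁ v₂ D → 1ℚ * v₁ - D * (0ℚ * v₂) ≡ v₁
    first = solve-∀ ℚ-ring
    second : ∀ v₁ v₂ → 1ℚ * v₂ + 0ℚ * v₁ ≡ v₂
    second = solve-∀ ℚ-ring

  mulF-lincomb : ∀ a x u y v → mulF d a ((x · u) ⊕ (y · v)) ≡ (x · mulF d a u) ⊕ (y · mulF d a v)
  mulF-lincomb (a₁ , a₂) x (u₁ , u₂) y (v₁ , v₂) =
    cong₂ _,_ (first a₁ a₂ x u₁ u₂ y v₁ v₂ D) (second a₁ a₂ x u₁ u₂ y v₁ v₂)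
    where
    first : ∀ a₁ a₂ x u₁ u₂ y v₁ v₂ D →
      a₁ * (x * u₁ + y * v₁) - D * (a₂ * (x * u₂ + y * v₂))
        ≡ x * (a₁ * u₁ - D * (a₂ * u₂)) + y * (a₁ * v₁ - D * (a₂ * v₂))
    first = solve-∀ ℚ-ring
    second : ∀ a₁ a₂ x u₁ u₂ y v₁ v₂ →
      a₁ * (x * u₂ + y * v₂) + a₂ * (x * u₁ + y * v₁) ≡ x * (a₁ * u₂ + a₂ * u₁) + y * (a₁ * v₂ + a₂ * v₁)
    second = solve-∀ ℚ-ring

  mulF-⊖ : ∀ a u v → mulF d a (u ⊖ v) ≡ mulF d a u ⊖ mulF d a v
  mulF-⊖ (a₁ , a₂) (u₁ , u₂) (v₁ , v₂) = cong₂ _,_ (first a₁ a₂ u₁ u₂ v₁ v₂ D) (second a₁ a₂ u₁ u₂ v₁ v₂)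
    where
    first : ∀ a₁ a₂ u₁ u₂ v₁ v₂ D →
      a₁ * (u₁ - v₁) - D * (a₂ * (u₂ - v₂)) ≡ (a₁ * u₁ - D * (a₂ * u₂)) - (a₁ * v₁ - D * (a₂ * v₂))
    first = solve-∀ ℚ-ring
    second : ∀ a₁ a₂ u₁ u₂ v₁ v₂ → a₁ * (u₂ - v₂) + a₂ * (u₁ - v₁) ≡ (a₁ * u₂ + a₂ * u₁) - (a₁ * v₂ + a₂ * v₁)
    second = solve-∀ ℚ-ring

  basisDet-mulF : ∀ a e f → basisDet (mulF d a e) (mulF d a f) ≡ normF d a * basisDet e f
  basisDet-mulF (a₁ , a₂) (e₁ , e₂) (f₁ , f₂) = identity a₁ a₂ e₁ e₂ f₁ f₂ D
    where
    identity : ∀ a₁ a₂ e₁ e₂ f₁ f₂ D →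
      (a₁ * e₁ - D * (a₂ * e₂)) * (a₁ * f₂ + a₂ * f₁) - (a₁ * f₁ - D * (a₂ * f₂)) * (a₁ * e₂ + a₂ * e₁)
        ≡ (a₁ * a₁ + D * (a₂ * a₂)) * (e₁ * f₂ - f₁ * e₂)
    identity = solve-∀ ℚ-ring

  -- ρ ∈ O⁺(F) is multiplication by an element of norm 1, and F is commutative.
  InO⁺-commutes : ∀ ρ → InO⁺ d ρ → ∀ a v → apply ρ (mulF d a v) ≡ mulF d a (apply ρ v)
  InO⁺-commutes ρ (ρ∈O , det≡1) a v = begin
    apply ρ (mulF d a v)              ≡⟨ cong (λ M → apply M (mulF d a v)) ρ≡u ⟩
    apply (multMat d u) (mulF d a v)  ≡⟨ apply-multMat d u (mulF d a v) ⟩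
    mulF d u (mulF d a v)             ≡⟨ mulF-assoc u a v ⟩
    mulF d (mulF d u a) v             ≡⟨ cong (λ z → mulF d z v) (mulF-comm u a) ⟩
    mulF d (mulF d a u) v             ≡⟨ mulF-assoc a u v ⟨
    mulF d a (mulF d u v)             ≡⟨ cong (mulF d a) (apply-multMat d u v) ⟨
    mulF d a (apply (multMat d u) v)  ≡⟨ cong (λ M → mulF d a (apply M v)) ρ≡u ⟨
    mulF d a (apply ρ v)              ∎
    where
    open ≡-Reasoning
    u = (Mat.m11 ρ , Mat.m21 ρ)
    ρ≡u : ρ ≡ multMat d u
    ρ≡u = Orthogonal.Proper.≡multMat d ρ ρ∈O det≡1

module _ (d : ℕ) where

  private
    D = ℕ→ℚ d

  mulF-·ˡ : ∀ c u v → mulF d (c · u) v ≡ c · mulF d u v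
  mulF-·ˡ c (u₁ , u₂) (v₁ , v₂) = cong₂ _,_ (first c u₁ u₂ v₁ v₂ D) (second c u₁ u₂ v₁ v₂)
    where
    first : ∀ c u₁ u₂ v₁ v₂ D → (c * u₁) * v₁ - D * ((c * u₂) * v₂) ≡ c * (u₁ * v₁ - D * (u₂ * v₂))
    first = solve-∀ ℚ-ring
    second : ∀ c u₁ u₂ v₁ v₂ → (c * u₁) * v₂ + (c * u₂) * v₁ ≡ c * (u₁ * v₂ + u₂ * v₁)
    second = solve-∀ ℚ-ring

·-·-inverse : ∀ c (c≢0 : ¬ c ≡ 0ℚ) v → (ℚ.1/_ c {{ℚ.≢-nonZero c≢0}}) · (c · v) ≡ v
·-·-inverse c c≢0 (v₁ , v₂) = cong₂ _,_ (cancel v₁) (cancel v₂)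
  where
  c⁻¹ = ℚ.1/_ c {{ℚ.≢-nonZero c≢0}}
  cancel : ∀ x → c⁻¹ * (c * x) ≡ x
  cancel x = trans (sym (ℚ.*-assoc c⁻¹ c x))
    (trans (cong (_* x) (ℚ.*-inverseˡ c {{ℚ.≢-nonZero c≢0}})) (ℚ.*-identityˡ x))

scale : ∀ d α → ¬ normF d α ≡ 0ℚ → Lattice → Lattice
scale d α Nα≢0 K = lattice (mulF d α (e₁ K)) (mulF d α (e₂ K))
  (λ det≡0 → *-≢0 Nα≢0 (indep K) (trans (sym (basisDet-mulF d α (e₁ K) (e₂ K))) det≡0))

module Scaling (d : ℕ) (α : F) (Nα≢0 : ¬ normF d α ≡ 0ℚ) where

  private
    N⁻¹ = ℚ.1/_ (normF d α) {{ℚ.≢-nonZero Nα≢0}}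

  α⁻¹ : F
  α⁻¹ = (proj₁ α * N⁻¹ , - (proj₂ α * N⁻¹))

  α⁻¹*α≡1 : mulF d α⁻¹ α ≡ 1F
  α⁻¹*α≡1 = cong₂ _,_
    (trans (first a b N⁻¹ (ℕ→ℚ d)) (ℚ.*-inverseʳ (normF d α) {{ℚ.≢-nonZero Nα≢0}}))
    (second a b N⁻¹ (ℕ→ℚ d))
    where
    a = proj₁ α
    b = proj₂ α
    first : ∀ a b t D → (a * t) * a - D * ((- (b * t)) * b) ≡ (a * a + D * (b * b)) * t
    first = solve-∀ ℚ-ring
    second : ∀ a b t D → (a * t) * b + (- (b * t)) * a ≡ 0ℚ
    second = solve-∀ ℚ-ring

  α⁻¹*α* : ∀ v → mulF d α⁻¹ (mulF d α v) ≡ v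
  α⁻¹*α* v = trans (mulF-assoc d α⁻¹ α v) (trans (cong (λ z → mulF d z v) α⁻¹*α≡1) (mulF-identityˡ d v))

  α*α⁻¹* : ∀ v → mulF d α (mulF d α⁻¹ v) ≡ v
  α*α⁻¹* v = trans (mulF-assoc d α α⁻¹ v)
    (trans (cong (λ z → mulF d z v) (trans (mulF-comm d α α⁻¹) α⁻¹*α≡1)) (mulF-identityˡ d v))

  Nα⁻¹≢0 : ¬ normF d α⁻¹ ≡ 0ℚ
  Nα⁻¹≢0 Nα⁻¹≡0 = ℚ.1≢0 (begin
    1ℚ                                ≡⟨ identity (ℕ→ℚ d) ⟩
    normF d 1F                        ≡⟨ cong (normF d) α⁻¹*α≡1 ⟨
    normF d (mulF d α⁻¹ α)            ≡⟨ normF-mulF d α⁻¹ α ⟩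
    normF d α⁻¹ * normF d α           ≡⟨ cong (_* normF d α) Nα⁻¹≡0 ⟩
    0ℚ * normF d α                    ≡⟨ ℚ.*-zeroˡ (normF d α) ⟩
    0ℚ                                ∎)
    where
    open ≡-Reasoning
    identity : ∀ D → 1ℚ ≡ 1ℚ * 1ℚ + D * (0ℚ * 0ℚ)
    identity = solve-∀ ℚ-ring

  αK : Lattice → Lattice
  αK = scale d α Nα≢0

  ∈-scale : ∀ K {v} → v ∈L K → mulF d α v ∈L αK K
  ∈-scale K {v} (m , n , v≡) = m , n , trans (cong (mulF d α) v≡) (mulF-lincomb d α (ℤ→ℚ m) (e₁ K) (ℤ→ℚ n) (e₂ K))

  ∈-scale⁻¹ : ∀ K {w} → w ∈L αK K → mulF d α⁻¹ w ∈L K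
  ∈-scale⁻¹ K {w} (m , n , w≡) = m , n , (begin
    mulF d α⁻¹ w
      ≡⟨ cong (mulF d α⁻¹) w≡ ⟩
    mulF d α⁻¹ ((ℤ→ℚ m · mulF d α (e₁ K)) ⊕ (ℤ→ℚ n · mulF d α (e₂ K)))
      ≡⟨ cong (mulF d α⁻¹) (mulF-lincomb d α (ℤ→ℚ m) (e₁ K) (ℤ→ℚ n) (e₂ K)) ⟨
    mulF d α⁻¹ (mulF d α (point K m n))
      ≡⟨ α⁻¹*α* (point K m n) ⟩
    point K m n ∎)
    where open ≡-Reasoning

  scale-scale⁻¹ : ∀ K → αK (scale d α⁻¹ Nα⁻¹≢0 K) ≐L K
  scale-scale⁻¹ K =
    (λ v (m , n , v≡) → m , n , trans v≡ (cong₂ (λ x y → (ℤ→ℚ m · x) ⊕ (ℤ→ℚ n · y)) (α*α⁻¹* (e₁ K)) (α*α⁻¹* (e₂ K)))) ,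
    (λ v (m , n , v≡) → m , n , trans v≡ (sym (cong₂ (λ x y → (ℤ→ℚ m · x) ⊕ (ℤ→ℚ n · y)) (α*α⁻¹* (e₁ K)) (α*α⁻¹* (e₂ K)))))

  scale⁻¹-scale : ∀ K → scale d α⁻¹ Nα⁻¹≢0 (αK K) ≐L K
  scale⁻¹-scale K =
    (λ v (m , n , v≡) → m , n , trans v≡ (cong₂ (λ x y → (ℤ→ℚ m · x) ⊕ (ℤ→ℚ n · y)) (α⁻¹*α* (e₁ K)) (α⁻¹*α* (e₂ K)))) ,
    (λ v (m , n , v≡) → m , n , trans v≡ (sym (cong₂ (λ x y → (ℤ→ℚ m · x) ⊕ (ℤ→ℚ n · y)) (α⁻¹*α* (e₁ K)) (α⁻¹*α* (e₂ K)))))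

  scale-≐ : ∀ {K K′} → K ≐L K′ → αK K ≐L αK K′
  scale-≐ {K} {K′} (K⊆K′ , K′⊆K) =
    (λ v v∈αK → subst (_∈L αK K′) (α*α⁻¹* v) (∈-scale K′ (K⊆K′ _ (∈-scale⁻¹ K v∈αK)))) ,
    (λ v v∈αK′ → subst (_∈L αK K) (α*α⁻¹* v) (∈-scale K (K′⊆K _ (∈-scale⁻¹ K′ v∈αK′))))

  module Transport (L₁ L₂ : Lattice) (L₂≐αL₁ : L₂ ≐L αK L₁) where

    into : ∀ {v} → v ∈L L₁ → mulF d α v ∈L L₂
    into {v} v∈L₁ = proj₂ L₂≐αL₁ (mulF d α v) (∈-scale L₁ v∈L₁)

    back : ∀ {w} → w ∈L L₂ → mulF d α⁻¹ w ∈L L₁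
    back {w} w∈L₂ = ∈-scale⁻¹ L₁ (proj₁ L₂≐αL₁ w w∈L₂)

    ⊆L-scale : ∀ K → K ⊆L L₁ → αK K ⊆L L₂
    ⊆L-scale K K⊆L₁ v v∈αK = subst (_∈L L₂) (α*α⁻¹* v) (into (K⊆L₁ _ (∈-scale⁻¹ K v∈αK)))

    HasIndex-scale : ∀ K {n} → HasIndex L₁ K n → HasIndex L₂ (αK K) n
    HasIndex-scale K = hasCard-map {P = _∈L L₁} {Q = _∈L L₂} {_≈_ = Congruent K} {_≈′_ = Congruent (αK K)}
      (mulF d α) into
      (λ w w∈L₂ → mulF d α⁻¹ w , back w∈L₂ , subst (Congruent (αK K) w) (sym (α*α⁻¹* w)) (congruent-refl (αK K) w))
      (λ {v} {v′} _ _ αv≋αv′ → subst (_∈L K) (trans (mulF-⊖ d α⁻¹ (mulF d α v) (mulF d α v′)) (cong₂ _⊖_ (α⁻¹*α* v) (α⁻¹*α* v′)))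
                                        (∈-scale⁻¹ K αv≋αv′))
      (λ {v} {v′} v≋v′ → subst (_∈L αK K) (mulF-⊖ d α v v′) (∈-scale K v≋v′))
      (λ {u} {v} {w} → congruent-trans (αK K) {u} {v} {w})

    module _ (ρ : Mat) (ρ-commutes : ∀ a v → apply ρ (mulF d a v) ≡ mulF d a (apply ρ v)) where

      Stable-scale : ∀ K → Stable ρ K → Stable ρ (αK K)
      Stable-scale K (ρK⊆K , K⊆ρK) =
        (λ v v∈αK → subst (_∈L αK K) (trans (sym (ρ-commutes α (mulF d α⁻¹ v))) (cong (apply ρ) (α*α⁻¹* v)))
                       (∈-scale K (ρK⊆K _ (∈-scale⁻¹ K v∈αK)))) ,
        (λ v v∈αK → let w , w∈K , ρw≡ = K⊆ρK _ (∈-scale⁻¹ K v∈αK)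
                    in mulF d α w , ∈-scale K w∈K , trans (ρ-commutes α w) (trans (cong (mulF d α) ρw≡) (α*α⁻¹* v)))

      Counted-scale : ∀ {inG n} K → Counted inG L₁ ρ n K → Counted inG L₂ ρ n (αK K)
      Counted-scale K (K⊆L₁ , index , stable) = ⊆L-scale K K⊆L₁ , HasIndex-scale K index , Stable-scale K stable

    private
      conjugateBy : F → F → Mat → Mat
      conjugateBy a b σ = compose (multMat d a) (compose σ (multMat d b))

      apply-conjugateBy : ∀ a b σ v → apply (conjugateBy a b σ) v ≡ mulF d a (apply σ (mulF d b v))
      apply-conjugateBy a b σ v = begin
        apply (compose (multMat d a) (compose σ (multMat d b))) v   ≡⟨ apply-compose (multMat d a) _ v ⟩
        apply (multMat d a) (apply (compose σ (multMat d b)) v)     ≡⟨ apply-multMat d a _ ⟩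
        mulF d a (apply (compose σ (multMat d b)) v)                ≡⟨ cong (mulF d a) (apply-compose σ (multMat d b) v) ⟩
        mulF d a (apply σ (apply (multMat d b) v))                  ≡⟨ cong (λ w → mulF d a (apply σ w)) (apply-multMat d b v) ⟩
        mulF d a (apply σ (mulF d b v))                             ∎
        where open ≡-Reasoning

      InO-conjugateBy : ∀ a b → (∀ v → mulF d a (mulF d b v) ≡ v) → ∀ σ → InO d σ → InO d (conjugateBy a b σ)
      InO-conjugateBy a b ab≡1 σ σ∈O v = begin
        normF d (apply (conjugateBy a b σ) v)            ≡⟨ cong (normF d) (apply-conjugateBy a b σ v) ⟩
        normF d (mulF d a (apply σ (mulF d b v)))        ≡⟨ normF-mulF d a _ ⟩
        normF d a * normF d (apply σ (mulF d b v))       ≡⟨ cong (normF d a *_) (σ∈O (mulF d b v)) ⟩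
        normF d a * normF d (mulF d b v)                 ≡⟨ normF-mulF d a (mulF d b v) ⟨
        normF d (mulF d a (mulF d b v))                  ≡⟨ cong (normF d) (ab≡1 v) ⟩
        normF d v                                        ∎
        where open ≡-Reasoning

    hasCard-images-scale : ∀ K {m} → HasCard (λ σ → InO d σ × ImageIn σ K L₁) _≡_ m →
                           HasCard (λ σ → InO d σ × ImageIn σ (αK K) L₂) _≡_ m
    hasCard-images-scale K = hasCard-map {_≈_ = _≡_} {_≈′_ = _≡_} (conjugateBy α α⁻¹)
      (λ {σ} (σ∈O , σK⊆L₁) → InO-conjugateBy α α⁻¹ α*α⁻¹* σ σ∈O , image σ σK⊆L₁)
      preimage
      (λ {σ} {σ′} _ _ e → mat-ext σ σ′ (λ v → begin
        apply σ v                                            ≡⟨ α⁻¹*α* (apply σ v) ⟨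
        mulF d α⁻¹ (mulF d α (apply σ v))                    ≡⟨ cong (λ w → mulF d α⁻¹ (mulF d α (apply σ w))) (α⁻¹*α* v) ⟨
        mulF d α⁻¹ (mulF d α (apply σ (mulF d α⁻¹ (mulF d α v))))  ≡⟨ cong (mulF d α⁻¹) (apply-conjugateBy α α⁻¹ σ (mulF d α v)) ⟨
        mulF d α⁻¹ (apply (conjugateBy α α⁻¹ σ) (mulF d α v))      ≡⟨ cong (λ M → mulF d α⁻¹ (apply M (mulF d α v))) e ⟩
        mulF d α⁻¹ (apply (conjugateBy α α⁻¹ σ′) (mulF d α v))     ≡⟨ cong (mulF d α⁻¹) (apply-conjugateBy α α⁻¹ σ′ (mulF d α v)) ⟩
        mulF d α⁻¹ (mulF d α (apply σ′ (mulF d α⁻¹ (mulF d α v)))) ≡⟨ cong (λ w → mulF d α⁻¹ (mulF d α (apply σ′ w))) (α⁻¹*α* v) ⟩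
        mulF d α⁻¹ (mulF d α (apply σ′ v))                   ≡⟨ α⁻¹*α* (apply σ′ v) ⟩
        apply σ′ v                                           ∎))
      (cong (conjugateBy α α⁻¹))
      trans
      where
      open ≡-Reasoning
      image : ∀ σ → ImageIn σ K L₁ → ImageIn (conjugateBy α α⁻¹ σ) (αK K) L₂
      image σ σK⊆L₁ v v∈αK = subst (_∈L L₂) (sym (apply-conjugateBy α α⁻¹ σ v)) (into (σK⊆L₁ _ (∈-scale⁻¹ K v∈αK)))
      preimage : ∀ τ → InO d τ × ImageIn τ (αK K) L₂ → Σ Mat λ σ → (InO d σ × ImageIn σ K L₁) × τ ≡ conjugateBy α α⁻¹ σ
      preimage τ (τ∈O , ταK⊆L₂) =
        conjugateBy α⁻¹ α τ ,
        (InO-conjugateBy α⁻¹ α α⁻¹*α* τ τ∈O ,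
         λ v v∈K → subst (_∈L L₁) (sym (apply-conjugateBy α⁻¹ α τ v)) (back (ταK⊆L₂ _ (∈-scale K v∈K)))) ,
        mat-ext τ (conjugateBy α α⁻¹ (conjugateBy α⁻¹ α τ)) (λ v → sym (begin
          apply (conjugateBy α α⁻¹ (conjugateBy α⁻¹ α τ)) v           ≡⟨ apply-conjugateBy α α⁻¹ (conjugateBy α⁻¹ α τ) v ⟩
          mulF d α (apply (conjugateBy α⁻¹ α τ) (mulF d α⁻¹ v))       ≡⟨ cong (mulF d α) (apply-conjugateBy α⁻¹ α τ (mulF d α⁻¹ v)) ⟩
          mulF d α (mulF d α⁻¹ (apply τ (mulF d α (mulF d α⁻¹ v))))   ≡⟨ α*α⁻¹* (apply τ (mulF d α (mulF d α⁻¹ v))) ⟩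
          apply τ (mulF d α (mulF d α⁻¹ v))                           ≡⟨ cong (apply τ) (α*α⁻¹* v) ⟩
          apply τ v                                                   ∎))

ZCoeff-scale : ∀ d α (Nα≢0 : ¬ normF d α ≡ 0ℚ) L₁ L₂ → L₂ ≐L scale d α Nα≢0 L₁ →
  ∀ ρ → (∀ a v → apply ρ (mulF d a v) ≡ mulF d a (apply ρ v)) →
  ∀ n c → ZCoeff (InO d) L₁ ρ n c → ZCoeff (InO d) L₂ ρ n c
ZCoeff-scale d α Nα≢0 L₁ L₂ L₂≐αL₁ ρ ρ-commutes n c (Ks , counted , complete , unique , ws , weights , c≡) =
  map αK Ks ,
  All.map⁺ (All.map (λ {K} → T.Counted-scale ρ ρ-commutes {InO d} {n} K) counted) ,
  complete′ ,
  AllPairs.map⁺ (AllPairs.map (λ {K} {K′} K≉K′ αK≐αK′ → K≉K′ (unscale K K′ αK≐αK′)) unique) ,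
  ws , weights′ Ks ws weights , c≡
  where
  open Scaling d α Nα≢0
  module T = Transport L₁ L₂ L₂≐αL₁
  module S⁻¹ = Scaling d α⁻¹ Nα⁻¹≢0
  α⁻¹K : Lattice → Lattice
  α⁻¹K = scale d α⁻¹ Nα⁻¹≢0

  L₁≐α⁻¹L₂ : L₁ ≐L α⁻¹K L₂
  L₁≐α⁻¹L₂ =
    (λ v v∈L₁ → subst (_∈L α⁻¹K L₂) (α⁻¹*α* v) (S⁻¹.∈-scale L₂ (T.into v∈L₁))) ,
    (λ w (m , n , w≡) → subst (_∈L L₁) (sym (trans w≡ (sym (mulF-lincomb d α⁻¹ (ℤ→ℚ m) (e₁ L₂) (ℤ→ℚ n) (e₂ L₂)))))
                          (T.back (m , n , refl)))
  module T⁻¹ = S⁻¹.Transport L₂ L₁ L₁≐α⁻¹L₂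

  unscale : ∀ K K′ → αK K ≐L αK K′ → K ≐L K′
  unscale K K′ αK≐αK′ =
    ≐L-trans {K} {α⁻¹K (αK K)} {K′} (≐L-sym {α⁻¹K (αK K)} {K} (scale⁻¹-scale K))
      (≐L-trans {α⁻¹K (αK K)} {α⁻¹K (αK K′)} {K′} (S⁻¹.scale-≐ {αK K} {αK K′} αK≐αK′) (scale⁻¹-scale K′))

  complete′ : ∀ K′ → Counted (InO d) L₂ ρ n K′ → Any (K′ ≐L_) (map αK Ks)
  complete′ K′ counted′ =
    Any.map⁺ (Any.map (λ {K} α⁻¹K′≐K → ≐L-trans {K′} {αK (α⁻¹K K′)} {αK K} (≐L-sym {αK (α⁻¹K K′)} {K′} (scale-scale⁻¹ K′))
                                          (scale-≐ {α⁻¹K K′} {K} α⁻¹K′≐K))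
      (complete (α⁻¹K K′) (T⁻¹.Counted-scale ρ ρ-commutes {InO d} {n} K′ counted′)))

  weights′ : ∀ Ls vs → Pointwise (Weight (InO d) L₁) Ls vs → Pointwise (Weight (InO d) L₂) (map αK Ls) vs
  weights′ [] [] [] = []
  weights′ (K ∷ Ls) (w ∷ vs) ((m , card , w*m≡1) ∷ rest) = (m , T.hasCard-images-scale K card , w*m≡1) ∷ weights′ Ls vs rest

-- Principal fractional ideals

module PrincipalIdeals {d : ℕ} (𝒪 : QuadraticOrder d) where

  open QuadraticOrder 𝒪
  open EuclideanDomain trace trace-small

  embed : ℤ² → F
  embed (m , n) = point R m n

  private
    D = ℕ→ℚ d
    T = ℤ→ℚ trace
    w₁ = proj₁ ω
    w₂ = proj₂ ω

  mulF-ω-basis : ∀ M N M′ N′ → mulF d ((M · 1F) ⊕ (N · ω)) ((M′ · 1F) ⊕ (N′ · ω))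
                              ≡ ((M * M′ - N * N′) · 1F) ⊕ ((M * N′ + N * M′ + T * (N * N′)) · ω)
  mulF-ω-basis M N M′ N′ = cong₂ _,_ first second
    where
    open ≡-Reasoning
    first : (M * 1ℚ + N * w₁) * (M′ * 1ℚ + N′ * w₁) - D * ((M * 0ℚ + N * w₂) * (M′ * 0ℚ + N′ * w₂))
            ≡ (M * M′ - N * N′) * 1ℚ + (M * N′ + N * M′ + T * (N * N′)) * w₁
    first = begin
      (M * 1ℚ + N * w₁) * (M′ * 1ℚ + N′ * w₁) - D * ((M * 0ℚ + N * w₂) * (M′ * 0ℚ + N′ * w₂))
        ≡⟨ expand M N M′ N′ w₁ w₂ D ⟩
      M * M′ + (M * N′ + N * M′) * w₁ + (N * N′) * (w₁ * w₁ - D * (w₂ * w₂))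
        ≡⟨ cong (λ z → M * M′ + (M * N′ + N * M′) * w₁ + (N * N′) * z) (cong proj₁ ω²) ⟩
      M * M′ + (M * N′ + N * M′) * w₁ + (N * N′) * (T * w₁ - 1ℚ)
        ≡⟨ collect M N M′ N′ w₁ T ⟩
      (M * M′ - N * N′) * 1ℚ + (M * N′ + N * M′ + T * (N * N′)) * w₁ ∎
      where
      expand : ∀ M N M′ N′ w₁ w₂ D →
        (M * 1ℚ + N * w₁) * (M′ * 1ℚ + N′ * w₁) - D * ((M * 0ℚ + N * w₂) * (M′ * 0ℚ + N′ * w₂))
          ≡ M * M′ + (M * N′ + N * M′) * w₁ + (N * N′) * (w₁ * w₁ - D * (w₂ * w₂))
      expand = solve-∀ ℚ-ring
      collect : ∀ M N M′ N′ w₁ T →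
        M * M′ + (M * N′ + N * M′) * w₁ + (N * N′) * (T * w₁ - 1ℚ)
          ≡ (M * M′ - N * N′) * 1ℚ + (M * N′ + N * M′ + T * (N * N′)) * w₁
      collect = solve-∀ ℚ-ring
    second : (M * 1ℚ + N * w₁) * (M′ * 0ℚ + N′ * w₂) + (M * 0ℚ + N * w₂) * (M′ * 1ℚ + N′ * w₁)
             ≡ (M * M′ - N * N′) * 0ℚ + (M * N′ + N * M′ + T * (N * N′)) * w₂
    second = begin
      (M * 1ℚ + N * w₁) * (M′ * 0ℚ + N′ * w₂) + (M * 0ℚ + N * w₂) * (M′ * 1ℚ + N′ * w₁)
        ≡⟨ expand M N M′ N′ w₁ w₂ ⟩
      (M * N′ + N * M′) * w₂ + (N * N′) * (w₁ * w₂ + w₂ * w₁)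
        ≡⟨ cong (λ z → (M * N′ + N * M′) * w₂ + (N * N′) * z) (cong proj₂ ω²) ⟩
      (M * N′ + N * M′) * w₂ + (N * N′) * (T * w₂ - 0ℚ)
        ≡⟨ collect M N M′ N′ w₂ T ⟩
      (M * M′ - N * N′) * 0ℚ + (M * N′ + N * M′ + T * (N * N′)) * w₂ ∎
      where
      expand : ∀ M N M′ N′ w₁ w₂ →
        (M * 1ℚ + N * w₁) * (M′ * 0ℚ + N′ * w₂) + (M * 0ℚ + N * w₂) * (M′ * 1ℚ + N′ * w₁)
          ≡ (M * N′ + N * M′) * w₂ + (N * N′) * (w₁ * w₂ + w₂ * w₁)
      expand = solve-∀ ℚ-ring
      collect : ∀ M N M′ N′ w₂ T →
        (M * N′ + N * M′) * w₂ + (N * N′) * (T * w₂ - 0ℚ)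
          ≡ (M * M′ - N * N′) * 0ℚ + (M * N′ + N * M′ + T * (N * N′)) * w₂
      collect = solve-∀ ℚ-ring

  embed-⊠ : ∀ a b → mulF d (embed a) (embed b) ≡ embed (a ⊠ b)
  embed-⊠ (m , n) (m′ , n′) =
    trans (mulF-ω-basis (ℤ→ℚ m) (ℤ→ℚ n) (ℤ→ℚ m′) (ℤ→ℚ n′)) (cong₂ (λ x y → (x · 1F) ⊕ (y · ω)) (sym real) (sym imaginary))
    where
    real : ℤ→ℚ (m ℤ.* m′ ℤ.- n ℤ.* n′) ≡ ℤ→ℚ m * ℤ→ℚ m′ - ℤ→ℚ n * ℤ→ℚ n′
    real = trans (ℤ→ℚ-minus (m ℤ.* m′) (n ℤ.* n′)) (cong₂ _-_ (ℤ→ℚ-* m m′) (ℤ→ℚ-* n n′))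
    imaginary : ℤ→ℚ (m ℤ.* n′ ℤ.+ n ℤ.* m′ ℤ.+ trace ℤ.* (n ℤ.* n′))
                ≡ ℤ→ℚ m * ℤ→ℚ n′ + ℤ→ℚ n * ℤ→ℚ m′ + T * (ℤ→ℚ n * ℤ→ℚ n′)
    imaginary = trans (ℤ→ℚ-+ (m ℤ.* n′ ℤ.+ n ℤ.* m′) (trace ℤ.* (n ℤ.* n′)))
      (cong₂ _+_ (ℤ→ℚ-lincomb m n′ n m′) (trans (ℤ→ℚ-* trace (n ℤ.* n′)) (cong (T *_) (ℤ→ℚ-* n n′))))

  embed-⊞ : ∀ a b → embed (a ⊞ b) ≡ embed a ⊕ embed b
  embed-⊞ (m , n) (m′ , n′) = cong₂ _,_ (component 1ℚ w₁) (component 0ℚ w₂)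
    where
    identity : ∀ a b c e x y → (a + c) * x + (b + e) * y ≡ (a * x + b * y) + (c * x + e * y)
    identity = solve-∀ ℚ-ring
    component : ∀ x y → ℤ→ℚ (m ℤ.+ m′) * x + ℤ→ℚ (n ℤ.+ n′) * y ≡ (ℤ→ℚ m * x + ℤ→ℚ n * y) + (ℤ→ℚ m′ * x + ℤ→ℚ n′ * y)
    component x y = trans (cong₂ (λ a b → a * x + b * y) (ℤ→ℚ-+ m m′) (ℤ→ℚ-+ n n′))
                          (identity (ℤ→ℚ m) (ℤ→ℚ n) (ℤ→ℚ m′) (ℤ→ℚ n′) x y)

  embed∈R : ∀ a → embed a ∈L R
  embed∈R (m , n) = m , n , refl

  module _ (I : Lattice) (R·I⊆I : ∀ r v → r ∈L R → v ∈L I → mulF d r v ∈L I) where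

    private
      a₁ = proj₁ (e₁ I)
      b₁ = proj₂ (e₁ I)
      a₂ = proj₁ (e₂ I)
      b₂ = proj₂ (e₂ I)

      N : ℕ
      N = ↧ₙ a₁ ℕ.* ↧ₙ b₁ ℕ.* ↧ₙ a₂ ℕ.* ↧ₙ b₂

      Nq = ℤ→ℚ (+ N)

      Nq≢0 : ¬ Nq ≡ 0ℚ
      Nq≢0 = ℤ→ℚ-suc≢0 (ℕ.pred N)

      N⁻¹ = ℚ.1/_ Nq {{ℚ.≢-nonZero Nq≢0}}

      integral-multiple : ∀ v → IsInteger (Nq * proj₁ v) → IsInteger (Nq * proj₂ v) → ∃ λ X → Nq · v ≡ embed X
      integral-multiple v (x , Nv₁≡x) (y , Nv₂≡y) =
        let m , n , xy≡ = ℤ²⊆R x y in (m , n) , trans (cong₂ _,_ Nv₁≡x Nv₂≡y) xy≡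

      X-data = integral-multiple (e₁ I)
        (multiple-of-denominator a₁ N (∣-trans (m∣m*n (↧ₙ b₁)) (∣-trans (m∣m*n (↧ₙ a₂)) (m∣m*n (↧ₙ b₂)))))
        (multiple-of-denominator b₁ N (∣-trans (n∣m*n (↧ₙ a₁)) (∣-trans (m∣m*n (↧ₙ a₂)) (m∣m*n (↧ₙ b₂)))))
      Y-data = integral-multiple (e₂ I)
        (multiple-of-denominator a₂ N (∣-trans (n∣m*n (↧ₙ a₁ ℕ.* ↧ₙ b₁)) (m∣m*n (↧ₙ b₂))))
        (multiple-of-denominator b₂ N (n∣m*n (↧ₙ a₁ ℕ.* ↧ₙ b₁ ℕ.* ↧ₙ a₂)))

      X Y : ℤ²
      X = proj₁ X-data
      Y = proj₁ Y-data

      open GCD (gcd X Y) renaming (gcd to G)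
      C₁ = proj₁ gcd∣x
      C₂ = proj₁ gcd∣y
      U = proj₁ bezout
      V = proj₁ (proj₂ bezout)

    -- α = gcd(N e₁, N e₂) / N for a common denominator N of the basis of I.
    generator : F
    generator = N⁻¹ · embed G

    private
      α = generator

      Nq·embed : ∀ {Z} v → Nq · v ≡ embed Z → N⁻¹ · embed Z ≡ v
      Nq·embed {Z} v Nv≡Z = trans (cong (N⁻¹ ·_) (sym Nv≡Z)) (·-·-inverse Nq Nq≢0 v)

      basis≡ : ∀ {Z} C v → Z ≡ C ⊠ G → Nq · v ≡ embed Z → v ≡ mulF d α (embed C)
      basis≡ {Z} C v Z≡CG Nv≡Z = sym (begin
        mulF d (N⁻¹ · embed G) (embed C)   ≡⟨ mulF-·ˡ d N⁻¹ (embed G) (embed C) ⟩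
        N⁻¹ · mulF d (embed G) (embed C)   ≡⟨ cong (N⁻¹ ·_) (mulF-comm d (embed G) (embed C)) ⟩
        N⁻¹ · mulF d (embed C) (embed G)   ≡⟨ cong (N⁻¹ ·_) (embed-⊠ C G) ⟩
        N⁻¹ · embed (C ⊠ G)                ≡⟨ cong (λ z → N⁻¹ · embed z) Z≡CG ⟨
        N⁻¹ · embed Z                      ≡⟨ Nq·embed {Z} v Nv≡Z ⟩
        v                                  ∎)
        where open ≡-Reasoning

      e₁≡αC₁ : e₁ I ≡ mulF d α (embed C₁)
      e₁≡αC₁ = basis≡ C₁ (e₁ I) (proj₂ gcd∣x) (proj₂ X-data)

      e₂≡αC₂ : e₂ I ≡ mulF d α (embed C₂)
      e₂≡αC₂ = basis≡ C₂ (e₂ I) (proj₂ gcd∣y) (proj₂ Y-data)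

      ·-⊕ : ∀ c u v → c · (u ⊕ v) ≡ (c · u) ⊕ (c · v)
      ·-⊕ c (u₁ , u₂) (v₁ , v₂) = cong₂ _,_ (ℚ.*-distribˡ-+ c u₁ v₁) (ℚ.*-distribˡ-+ c u₂ v₂)

      α-combination : α ≡ mulF d (embed U) (e₁ I) ⊕ mulF d (embed V) (e₂ I)
      α-combination = begin
        N⁻¹ · embed G                                                   ≡⟨ cong (λ z → N⁻¹ · embed z) (proj₂ (proj₂ bezout)) ⟩
        N⁻¹ · embed (U ⊠ X ⊞ V ⊠ Y)                                     ≡⟨ cong (N⁻¹ ·_) (embed-⊞ (U ⊠ X) (V ⊠ Y)) ⟩
        N⁻¹ · (embed (U ⊠ X) ⊕ embed (V ⊠ Y))                           ≡⟨ ·-⊕ N⁻¹ (embed (U ⊠ X)) (embed (V ⊠ Y)) ⟩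
        (N⁻¹ · embed (U ⊠ X)) ⊕ (N⁻¹ · embed (V ⊠ Y))                   ≡⟨ cong₂ _⊕_ (scaled U X (e₁ I) (proj₂ X-data))
                                                                                     (scaled V Y (e₂ I) (proj₂ Y-data)) ⟩
        mulF d (embed U) (e₁ I) ⊕ mulF d (embed V) (e₂ I)               ∎
        where
        open ≡-Reasoning
        scaled : ∀ W Z v → Nq · v ≡ embed Z → N⁻¹ · embed (W ⊠ Z) ≡ mulF d (embed W) v
        scaled W Z v Nv≡Z = begin
          N⁻¹ · embed (W ⊠ Z)                   ≡⟨ cong (N⁻¹ ·_) (embed-⊠ W Z) ⟨
          N⁻¹ · mulF d (embed W) (embed Z)      ≡⟨ cong (N⁻¹ ·_) (mulF-comm d (embed W) (embed Z)) ⟩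
          N⁻¹ · mulF d (embed Z) (embed W)      ≡⟨ mulF-·ˡ d N⁻¹ (embed Z) (embed W) ⟨
          mulF d (N⁻¹ · embed Z) (embed W)      ≡⟨ cong (λ z → mulF d z (embed W)) (Nq·embed {Z} v Nv≡Z) ⟩
          mulF d v (embed W)                    ≡⟨ mulF-comm d v (embed W) ⟩
          mulF d (embed W) v                    ∎

    generator-norm≢0 : ¬ normF d generator ≡ 0ℚ
    generator-norm≢0 Nα≡0 = indep I (begin
      latticeDet I                                                ≡⟨ cong₂ basisDet e₁≡αC₁ e₂≡αC₂ ⟩
      basisDet (mulF d α (embed C₁)) (mulF d α (embed C₂))        ≡⟨ basisDet-mulF d α (embed C₁) (embed C₂) ⟩
      normF d α * basisDet (embed C₁) (embed C₂)                  ≡⟨ cong (_* basisDet (embed C₁) (embed C₂)) Nα≡0 ⟩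
      0ℚ * basisDet (embed C₁) (embed C₂)                         ≡⟨ ℚ.*-zeroˡ (basisDet (embed C₁) (embed C₂)) ⟩
      0ℚ                                                          ∎)
      where open ≡-Reasoning

    principal : I ≐L scale d generator generator-norm≢0 R
    principal = I⊆αR , ⊆L-intro (scale d α generator-norm≢0 R) I α1∈I αω∈I
      where
      I⊆αR : I ⊆L scale d α generator-norm≢0 R
      I⊆αR v (m , n , v≡) =
        subst (_∈L scale d α generator-norm≢0 R) (sym v≡αc)
          (Scaling.∈-scale d α generator-norm≢0 R (∈L-lincomb R (embed∈R C₁) (embed∈R C₂) m n))
        where
        v≡αc : v ≡ mulF d α ((ℤ→ℚ m · embed C₁) ⊕ (ℤ→ℚ n · embed C₂))
        v≡αc = trans v≡ (trans (cong₂ (λ x y → (ℤ→ℚ m · x) ⊕ (ℤ→ℚ n · y)) e₁≡αC₁ e₂≡αC₂)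
                               (sym (mulF-lincomb d α (ℤ→ℚ m) (embed C₁) (ℤ→ℚ n) (embed C₂))))
      α∈I : α ∈L I
      α∈I = subst (_∈L I) (sym α-combination)
              (∈L-⊕ I (R·I⊆I _ _ (embed∈R U) (∈L-e₁ I)) (R·I⊆I _ _ (embed∈R V) (∈L-e₂ I)))
      α1∈I : mulF d α 1F ∈L I
      α1∈I = subst (_∈L I) (sym (trans (mulF-comm d α 1F) (mulF-identityˡ d α))) α∈I
      αω∈I : mulF d α ω ∈L I
      αω∈I = subst (_∈L I) (mulF-comm d ω α) (R·I⊆I ω α (∈L-e₂ R) α∈I)

module _ {d : ℕ} {{_ : NonZero d}} (𝒪 : QuadraticOrder d) where

  open QuadraticOrder 𝒪

  coefficients-of-ideals : ∀ I → (∀ r v → r ∈L R → v ∈L I → mulF d r v ∈L I) →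
    ∀ ρ → InO⁺ d ρ → FiniteOrder ρ → ∀ n →
    Σ ℚ λ c → Σ ℚ λ c⁺ → ZCoeff (InO d) I ρ n c × ZCoeff (InO⁺ d) R ρ n c⁺ × c ≡ ½ * c⁺
  coefficients-of-ideals I R·I⊆I ρ ρ∈O⁺ ρ-finite n =
    let c , c⁺ , Z , Z⁺ , c≡½c⁺ = CoefficientsOfR.coefficients 𝒪 ρ ρ-finite n
    in c , c⁺ , ZCoeff-scale d α Nα≢0 R I (principal I R·I⊆I) ρ (InO⁺-commutes d ρ ρ∈O⁺) n c Z , Z⁺ , c≡½c⁺
    where
    open PrincipalIdeals 𝒪
    α = generator I R·I⊆I
    Nα≢0 = generator-norm≢0 I R·I⊆I

gaussianIntegers : QuadraticOrder 1
gaussianIntegers = record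
  { ω             = 0ℚ , 1ℚ
  ; ω-independent = 1≢0
  ; trace         = + 0
  ; trace-small   = inj₁ refl
  ; ω²            = refl
  ; ℤ²⊆R          = λ a b → a , b , cong₂ _,_ (first (ℤ→ℚ a) (ℤ→ℚ b)) (second (ℤ→ℚ a) (ℤ→ℚ b))
  ; half-integral = λ { v (m , n , refl) →
      (m ℤ.+ m , trans (double₁ (ℤ→ℚ m) (ℤ→ℚ n)) (sym (ℤ→ℚ-+ m m))) ,
      (n ℤ.+ n , trans (double₂ (ℤ→ℚ m) (ℤ→ℚ n)) (sym (ℤ→ℚ-+ n n))) }
  ; conj-stable   = ImageIn-intro conjMat R R (+ 1 , + 0 , refl) (+ 0 , -[1+ 0 ] , refl)
  }
  where
  R = lattice 1F (0ℚ , 1ℚ) 1≢0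
  first : ∀ a b → a ≡ a * 1ℚ + b * 0ℚ
  first = solve-∀ ℚ-ring
  second : ∀ a b → b ≡ a * 0ℚ + b * 1ℚ
  second = solve-∀ ℚ-ring
  double₁ : ∀ m n → ℤ→ℚ (+ 2) * (m * 1ℚ + n * 0ℚ) ≡ m + m
  double₁ = solve-∀ ℚ-ring
  double₂ : ∀ m n → ℤ→ℚ (+ 2) * (m * 0ℚ + n * 1ℚ) ≡ n + n
  double₂ = solve-∀ ℚ-ring

-- ω = (1 + √-3)/2, so a + b√-3 = (a - b) + 2b ω.
eisensteinIntegers : QuadraticOrder 3
eisensteinIntegers = record
  { ω             = ½ , ½
  ; ω-independent = ½≢0
  ; trace         = + 1
  ; trace-small   = inj₂ refl
  ; ω²            = refl
  ; ℤ²⊆R          = λ a b → a ℤ.- b , b ℤ.+ b ,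
      cong₂ _,_ (trans (first (ℤ→ℚ a) (ℤ→ℚ b)) (sym (cong₂ (λ x y → x * 1ℚ + y * ½) (ℤ→ℚ-minus a b) (ℤ→ℚ-+ b b))))
                (trans (second (ℤ→ℚ a) (ℤ→ℚ b)) (sym (cong₂ (λ x y → x * 0ℚ + y * ½) (ℤ→ℚ-minus a b) (ℤ→ℚ-+ b b))))
  ; half-integral = λ { v (m , n , refl) →
      (m ℤ.+ m ℤ.+ n , trans (double₁ (ℤ→ℚ m) (ℤ→ℚ n)) (sym (trans (ℤ→ℚ-+ (m ℤ.+ m) n) (cong (_+ ℤ→ℚ n) (ℤ→ℚ-+ m m))))) ,
      (n , double₂ (ℤ→ℚ m) (ℤ→ℚ n)) }
  ; conj-stable   = ImageIn-intro conjMat R R (+ 1 , + 0 , refl) (+ 1 , -[1+ 0 ] , refl)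
  }
  where
  R = lattice 1F (½ , ½) ½≢0
  first : ∀ a b → a ≡ (a - b) * 1ℚ + (b + b) * ½
  first = solve-∀ ℚ-ring
  second : ∀ a b → b ≡ (a - b) * 0ℚ + (b + b) * ½
  second = solve-∀ ℚ-ring
  double₁ : ∀ m n → ℤ→ℚ (+ 2) * (m * 1ℚ + n * ½) ≡ m + m + n
  double₁ = solve-∀ ℚ-ring
  double₂ : ∀ m n → ℤ→ℚ (+ 2) * (m * 0ℚ + n * ½) ≡ n
  double₂ = solve-∀ ℚ-ring

proposition4p2 : (d : ℕ) → (d ≡ 1 ⊎ d ≡ 3) →
    (I : Lattice) → IsFractionalIdeal d I →
    (ρ : Mat) → InO⁺ d ρ → FiniteOrder ρ →
    (n : ℕ) → 1 ≤ n →
    Σ ℚ λ c → Σ ℚ λ c⁺ →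
      ZCoeff (InO d) I ρ n c × ZCoeff (InO⁺ d) (ringOfIntegers d) ρ n c⁺
        × c ≡ ½ * c⁺
proposition4p2 _ (inj₁ refl) I I-ideal ρ ρ∈O⁺ ρ-finite n _ =
  coefficients-of-ideals gaussianIntegers I I-ideal ρ ρ∈O⁺ ρ-finite n
proposition4p2 _ (inj₂ refl) I I-ideal ρ ρ∈O⁺ ρ-finite n _ =
  coefficients-of-ideals eisensteinIntegers I I-ideal ρ ρ∈O⁺ ρ-finite n
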